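{- Let $G$ be a chordal$^*$ graph on $n$ vertices and let $G^c$ be the complementary graph of $G$. Then $$\kappa(G) + \tau_{\max}(G^c) \le n-1$$ and $$0 \leq \kappa(G) \leq (n - 1) - \lceil 2\sqrt{n}-2\,\rceil.$$ Furthermore, for every integer $\kappa$ with $0 \leq \kappa \leq (n - 1) - \lceil 2\sqrt{n}-2\,\rceil$, there exists a chordal$^*$ graph $G$ on $n$ vertices satisfying $\kappa(G) = \kappa$.
   Context: All graphs are finite and simple (no loops, no multiple edges). A graph is chordal if every cycle of length at least $4$ has a chord. A vertex $x$ of $G$ is universal if $x$ is adjacent to every other vertex of $G$. A chordal$^*$ graph is a chordal graph with no universal vertex. The complementary graph $G^c$ has the same vertex set as $G$, with $\{x,y\}$ ($x\neq y$) an edge of $G^c$ iff it is not an edge of $G$. The vertex connectivity $\kappa(G)$ is the minimum cardinality of a subset $W \subset V(G)$ such that the induced subgraph of $G$ on $V(G)\setminus W$ is disconnected (so $\kappa(G)=0$ if $G$ is disconnected). A vertex cover of a graph $H$ is a subset $C\subset V(H)$ meeting every edge of $H$; $\tau_{\max}(H)$ denotes the maximum cardinality of a minimal (with respect to inclusion) vertex cover of $H$. -}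

module Defs where

open import Data.Nat using (ℕ; zero; suc; _+_; _*_; _≤_)
open import Data.Fin using (Fin; toℕ; _≟_)
open import Data.Fin.Subset using (Subset; _∈_; _∉_; _⊆_; ∣_∣)
open import Data.Bool using (Bool; true; false; not; if_then_else_; T)
open import Data.Product using (Σ; ∃; _×_; _,_)
open import Data.Sum using (_⊎_)
open import Relation.Nullary using (¬_)
open import Relation.Nullary.Decidable using (⌊_⌋)
open import Relation.Binary.PropositionalEquality using (_≡_; _≢_)

record Graph (n : ℕ) : Set where
  constructor graph
  field
    adj : Fin n → Fin n → Bool

open Graph public

Adj : ∀ {n} → Graph n → Fin n → Fin n → Set
Adj G u v = T (adj G u v)

IsSimple : ∀ {n} → Graph n → Set
IsSimple G = (∀ u v → Adj G u v → Adj G v u) × (∀ u → ¬ Adj G u u)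

complement : ∀ {n} → Graph n → Graph n
complement G = graph (λ u v → if ⌊ u ≟ v ⌋ then false else not (adj G u v))

CycNb : (k : ℕ) → Fin k → Fin k → Set
CycNb k i j =
  (suc (toℕ i) ≡ toℕ j) ⊎ (suc (toℕ j) ≡ toℕ i)
  ⊎ ((toℕ i ≡ 0 × suc (toℕ j) ≡ k) ⊎ (toℕ j ≡ 0 × suc (toℕ i) ≡ k))

record Cycle≥4 {n : ℕ} (G : Graph n) : Set where
  field
    len     : ℕ
    len≥4   : 4 ≤ len
    vert    : Fin len → Fin n
    inj     : ∀ i j → vert i ≡ vert j → i ≡ j
    edges   : ∀ i j → CycNb len i j → Adj G (vert i) (vert j)

open Cycle≥4 public

HasChord : ∀ {n} {G : Graph n} → Cycle≥4 G → Set
HasChord {G = G} C =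
  ∃ λ i → ∃ λ j → i ≢ j × ¬ CycNb (len C) i j × Adj G (vert C i) (vert C j)

Chordal : ∀ {n} → Graph n → Set
Chordal G = (C : Cycle≥4 G) → HasChord C

Universal : ∀ {n} → Graph n → Fin n → Set
Universal G x = ∀ y → y ≢ x → Adj G x y

Chordal* : ∀ {n} → Graph n → Set
Chordal* G = Chordal G × ¬ (∃ λ x → Universal G x)

data Reach {n : ℕ} (G : Graph n) (W : Subset n) : Fin n → Fin n → Set where
  here : ∀ {u} → u ∉ W → Reach G W u u
  step : ∀ {u w v} → u ∉ W → Adj G u w → Reach G W w v → Reach G W u v

Separating : ∀ {n} → Graph n → Subset n → Set
Separating G W = ∃ λ u → ∃ λ v → u ∉ W × v ∉ W × ¬ Reach G W u v

IsConnectivity : ∀ {n} → Graph n → ℕ → Set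
IsConnectivity G k =
  (∃ λ W → Separating G W × ∣ W ∣ ≡ k) × (∀ W → Separating G W → k ≤ ∣ W ∣)

VertexCover : ∀ {n} → Graph n → Subset n → Set
VertexCover H C = ∀ u v → Adj H u v → (u ∈ C ⊎ v ∈ C)

MinimalVertexCover : ∀ {n} → Graph n → Subset n → Set
MinimalVertexCover H C =
  VertexCover H C × (∀ D → D ⊆ C → VertexCover H D → C ⊆ D)

IsTauMax : ∀ {n} → Graph n → ℕ → Set
IsTauMax H t =
  (∃ λ C → MinimalVertexCover H C × ∣ C ∣ ≡ t)
  × (∀ C → MinimalVertexCover H C → ∣ C ∣ ≤ t)

-- c = ⌈2√n⌉ : the least natural number c with 2√n ≤ c, i.e. 4n ≤ c²
IsCeilTwoSqrt : ℕ → ℕ → Set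
IsCeilTwoSqrt n c = (4 * n ≤ c * c) × (∀ m → 4 * n ≤ m * m → c ≤ m)

module Submission where

-- Let C be a maximum minimal vertex cover of Gᶜ. Then Q = V − C is a maximal clique of G, and Q ≠ V
-- since G has no universal vertex. By chordality some q ∈ Q has no neighbour in the component of G − Q
-- containing a vertex z ∉ Q (otherwise an induced path through that component yields a vertex adjacent
-- to all of Q, or a chordless cycle), so Q − q separates z from q and κ ≤ ∣Q∣ − 1 = n − 1 − τmax.
--
-- For the second bound let x be a simplicial vertex of minimum degree d among the simplicial vertices
-- (by Dirac every vertex misses some simplicial vertex), and r = n − 1 − d. Choose for every neighbour
-- of x a simplicial vertex it misses; a smallest such choice Y is independent, and by minimality of d
-- each y ∈ Y misses at most r − ∣Y∣ neighbours of x, so d ≤ ∣Y∣(r − ∣Y∣) ≤ r²/4. As N(x) separates,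
-- κ ≤ d, and 4(n − 1 − r) ≤ r² gives ⌈2√n⌉ ≤ r + 2.
--
-- Every smaller κ is attained by a split graph: a clique of size s and m independent vertices, each
-- missing a window of s − κ consecutive clique vertices.
--
-- The arguments run in the double-negation monad, which suffices as all conclusions are decidable.

open import Defs
open import Data.Nat using (ℕ; zero; suc; _+_; _*_; _∸_; _≤_; _<_; z≤n; s≤s; _≤ᵇ_; _<ᵇ_; _≤?_; _<?_)
open import Data.Nat.Properties hiding (_≟_)
open import Data.Nat.Tactic.RingSolver using (solve-∀)
open import Data.Fin using (Fin; toℕ; fromℕ<; _≟_) renaming (zero to fzero; suc to fsuc)
open import Data.Fin.Properties using (toℕ-injective; toℕ<n; toℕ-fromℕ<; any?)
open import Data.Fin.Subset using (Subset; _∈_; _∉_; ∣_∣; ∁; _-_; ⁅_⁆)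
open import Data.Fin.Subset.Properties using (x∈p∧x≢y⇒x∈p-y; p─q⊆p; x∈p⇒∣p-x∣<∣p∣; ∣∁p∣≡n∸∣p∣; ∣p∣≤n; x∉p⇒x∈∁p; x∈p⇒x∉∁p)
open import Data.Vec using ([]; _∷_; tabulate; lookup; here; there)
open import Data.Vec.Properties using ([]=⇒lookup; lookup⇒[]=; lookup∘tabulate)
open import Data.Bool using (Bool; true; false; not; if_then_else_; T; _∧_)
open import Data.Bool.Properties using (T?; ∧-comm)
open import Data.Unit using (tt)
open import Data.Empty using (⊥; ⊥-elim)
open import Data.Product using (Σ; ∃; _×_; _,_; proj₁; proj₂)
open import Data.Sum using (_⊎_; inj₁; inj₂; [_,_]′; swap)
open import Relation.Nullary using (¬_; Dec; yes; no; contradiction)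
open import Relation.Nullary.Decidable using (⌊_⌋; ¬¬-excluded-middle; decidable-stable)
open import Relation.Nullary.Negation using (¬¬-Monad)
open import Relation.Nullary.Negation.Core using (DoubleNegation)
open import Relation.Binary.PropositionalEquality using (_≡_; _≢_; refl; sym; trans; cong; cong₂; subst; subst₂; module ≡-Reasoning)
open import Relation.Binary.Definitions using (tri<; tri≈; tri>)
open import Function using (_∘_)
open import Effect.Monad using (RawMonad)
open import Level using (0ℓ)
open import Algebra.Properties.Semiring.Sum +-*-semiring using (sum; sum-cong-≗; ∑-distrib-+; ∑-comm; *-distribˡ-sum)

open RawMonad (¬¬-Monad {0ℓ}) using (pure; _>>=_)

¬¬-dec-pointwise : ∀ n (P : Fin n → Set) → DoubleNegation (∀ i → Dec (P i))
¬¬-dec-pointwise zero P = pure (λ ())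
¬¬-dec-pointwise (suc n) P = do
  d₀ ← ¬¬-excluded-middle
  ds ← ¬¬-dec-pointwise n (P ∘ fsuc)
  pure λ { fzero → d₀ ; (fsuc i) → ds i }

record Characteristic {n} (P : Fin n → Set) : Set where
  field
    χ : Fin n → Bool
    sound : ∀ i → T (χ i) → P i
    complete : ∀ i → P i → T (χ i)

¬¬-characteristic : ∀ {n} (P : Fin n → Set) → DoubleNegation (Characteristic P)
¬¬-characteristic {n} P = do
  ds ← ¬¬-dec-pointwise n P
  pure record { χ = λ i → ⌊ ds i ⌋ ; sound = λ i → sound (ds i) ; complete = λ i → complete (ds i) }
  where
  sound : ∀ {i} (d : Dec (P i)) → T ⌊ d ⌋ → P i
  sound (yes p) _ = p
  complete : ∀ {i} (d : Dec (P i)) → P i → T ⌊ d ⌋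
  complete (yes _) _ = tt
  complete (no ¬p) p = ¬p p

¬¬-choice : ∀ {n} {P : Fin n → Set} → (∀ i → DoubleNegation (P i)) → DoubleNegation (∀ i → P i)
¬¬-choice {zero} h = pure (λ ())
¬¬-choice {suc n} {P} h = do
  p₀ ← h fzero
  ps ← ¬¬-choice {P = P ∘ fsuc} (h ∘ fsuc)
  pure λ { fzero → p₀ ; (fsuc i) → ps i }

¬¬-minimum : ∀ {A : Set} (P : A → Set) (f : A → ℕ) → Σ A P →
             DoubleNegation (Σ A λ a → P a × ∀ b → P b → f a ≤ f b)
¬¬-minimum {A} P f (a₀ , p₀) = go (f a₀) a₀ p₀ ≤-refl
  where
  go : ∀ N a → P a → f a ≤ N → DoubleNegation (Σ A λ a → P a × ∀ b → P b → f a ≤ f b)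
  go N a pa fa≤N = ¬¬-excluded-middle >>= λ where
      (no ∄smaller) → pure (a , pa , λ b pb → ≮⇒≥ (λ lt → ∄smaller (b , pb , lt)))
      (yes (b , pb , fb<fa)) → descend N fa≤N b pb fb<fa
    where
    descend : ∀ M → f a ≤ M → ∀ b → P b → f b < f a → DoubleNegation (Σ A λ a → P a × ∀ b → P b → f a ≤ f b)
    descend (suc M) fa≤M b pb lt = go M b pb (≤-pred (<-≤-trans lt fa≤M))
    descend zero fa≤0 b pb lt = ⊥-elim (n≮0 (<-≤-trans lt fa≤0))

T-∧-intro : ∀ {a b} → T a → T b → T (a ∧ b)
T-∧-intro {true} {true} _ _ = tt

T-∧-fst : ∀ {a b} → T (a ∧ b) → T a
T-∧-fst {true} _ = tt

T-∧-snd : ∀ {a b} → T (a ∧ b) → T b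
T-∧-snd {true} {true} _ = tt

T-not-intro : ∀ {a} → ¬ T a → T (not a)
T-not-intro {false} _ = tt
T-not-intro {true} h = h tt

T-not-elim : ∀ {a} → T (not a) → ¬ T a
T-not-elim {false} _ ()

T⇒≡true : ∀ {b} → T b → b ≡ true
T⇒≡true {true} _ = refl

¬T⇒≡false : ∀ {b} → ¬ T b → b ≡ false
¬T⇒≡false {false} _ = refl
¬T⇒≡false {true} h = ⊥-elim (h tt)

if-true : ∀ {A : Set} {b} {x y : A} → T b → (if b then x else y) ≡ x
if-true {b = true} _ = refl

if-false : ∀ {A : Set} {b} {x y : A} → ¬ T b → (if b then x else y) ≡ y
if-false {b = false} _ = refl
if-false {b = true} h = ⊥-elim (h tt)

if-≤ᵇ-yes : ∀ {A : Set} {i m} {x y : A} → i ≤ m → (if i ≤ᵇ m then x else y) ≡ x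
if-≤ᵇ-yes p = if-true (≤⇒≤ᵇ p)

if-≤ᵇ-no : ∀ {A : Set} {i m} {x y : A} → m < i → (if i ≤ᵇ m then x else y) ≡ y
if-≤ᵇ-no {i = i} {m} p = if-false (λ t → <⇒≱ p (≤ᵇ⇒≤ i m t))

T<ᵇ⇒< : ∀ {m n} → T (m <ᵇ n) → m < n
T<ᵇ⇒< {m} {n} = <ᵇ⇒< m n

T≤ᵇ⇒≤ : ∀ {m n} → T (m ≤ᵇ n) → m ≤ n
T≤ᵇ⇒≤ {m} {n} = ≤ᵇ⇒≤ m n

≤-stable : ∀ {a b} → DoubleNegation (a ≤ b) → a ≤ b
≤-stable = decidable-stable (_ ≤? _)

T-≟⇒≡ : ∀ {n} {i j : Fin n} → T ⌊ i ≟ j ⌋ → i ≡ j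
T-≟⇒≡ {i = i} {j} t with i ≟ j
... | yes e = e

≟-sym : ∀ {n} (u v : Fin n) → ⌊ u ≟ v ⌋ ≡ ⌊ v ≟ u ⌋
≟-sym u v with u ≟ v | v ≟ u
... | yes _ | yes _ = refl
... | no _ | no _ = refl
... | yes e | no ne = ⊥-elim (ne (sym e))
... | no ne | yes e = ⊥-elim (ne (sym e))

≢⇒≟-false : ∀ {n} {u v : Fin n} → u ≢ v → ⌊ u ≟ v ⌋ ≡ false
≢⇒≟-false {u = u} {v} u≢v with u ≟ v
... | yes e = ⊥-elim (u≢v e)
... | no _ = refl

greatest-below : (P : ℕ → Set) → (∀ i → Dec (P i)) → P 0 → ∀ m → Σ ℕ λ i → i ≤ m × P i × (∀ j → i < j → j ≤ m → ¬ P j)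
greatest-below P d p0 zero = 0 , z≤n , p0 , λ j i<j j≤ → ⊥-elim (<⇒≱ i<j j≤)
greatest-below P d p0 (suc m) with d (suc m)
... | yes ps = suc m , ≤-refl , ps , λ j i<j j≤ → ⊥-elim (<⇒≱ i<j j≤)
... | no nps with greatest-below P d p0 m
...   | i , i≤ , pi , mx = i , ≤-trans i≤ (n≤1+n m) , pi , h
  where
  h : ∀ j → i < j → j ≤ suc m → ¬ P j
  h j i<j j≤ with m≤n⇒m<n∨m≡n j≤
  ... | inj₁ j< = mx j i<j (≤-pred j<)
  ... | inj₂ refl = nps

4xy≤[x+y]² : ∀ x y → 4 * (x * y) ≤ (x + y) * (x + y)
4xy≤[x+y]² x y = [ ordered x y , (λ y≤x → subst₂ (λ a b → 4 * a ≤ b) (*-comm y x) (cong (λ z → z * z) (+-comm y x)) (ordered y x y≤x)) ]′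
                   (≤-total x y)
  where
  expand : ∀ x f → (x + (x + f)) * (x + (x + f)) ≡ 4 * (x * (x + f)) + f * f
  expand = solve-∀
  ordered : ∀ x y → x ≤ y → 4 * (x * y) ≤ (x + y) * (x + y)
  ordered x y x≤y with m≤n⇒∃[o]m+o≡n x≤y
  ... | f , refl = subst (4 * (x * (x + f)) ≤_) (sym (expand x f)) (m≤m+n _ _)

𝟙 : Bool → ℕ
𝟙 true = 1
𝟙 false = 0

count : ∀ {n} → (Fin n → Bool) → ℕ
count f = sum (𝟙 ∘ f)

sum-mono-≤ : ∀ {n} {f g : Fin n → ℕ} → (∀ i → f i ≤ g i) → sum f ≤ sum g
sum-mono-≤ {zero} h = z≤n
sum-mono-≤ {suc n} h = +-mono-≤ (h fzero) (sum-mono-≤ (h ∘ fsuc))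

term≤sum : ∀ {n} (f : Fin n → ℕ) (i : Fin n) → f i ≤ sum f
term≤sum {suc n} f fzero = m≤m+n _ _
term≤sum {suc n} f (fsuc i) = ≤-trans (term≤sum (f ∘ fsuc) i) (m≤n+m _ _)

count-true : ∀ n → count {n} (λ _ → true) ≡ n
count-true zero = refl
count-true (suc n) = cong suc (count-true n)

count-false : ∀ n → count {n} (λ _ → false) ≡ 0
count-false zero = refl
count-false (suc n) = count-false n

count-singleton : ∀ {n} (x : Fin n) → count (λ i → ⌊ i ≟ x ⌋) ≡ 1
count-singleton {suc n} fzero = cong suc (trans (sum-cong-≗ {n} (λ i → cong 𝟙 (≢⇒≟-false {u = fsuc i} {fzero} λ ()))) (count-false n))
count-singleton {suc n} (fsuc x) =
  trans (cong₂ _+_ (cong 𝟙 (≢⇒≟-false {u = fzero} {fsuc x} λ ())) (sum-cong-≗ (λ i → cong 𝟙 (≟-suc i))))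
        (count-singleton x)
  where
  ≟-suc : ∀ i → ⌊ fsuc i ≟ fsuc x ⌋ ≡ ⌊ i ≟ x ⌋
  ≟-suc i with fsuc i ≟ fsuc x | i ≟ x
  ... | yes _ | yes _ = refl
  ... | no _ | no _ = refl
  ... | yes refl | no i≢x = ⊥-elim (i≢x refl)
  ... | no si≢sx | yes refl = ⊥-elim (si≢sx refl)

count-mono : ∀ {n} {f g : Fin n → Bool} → (∀ i → T (f i) → T (g i)) → count f ≤ count g
count-mono {f = f} {g} h = sum-mono-≤ (λ i → 𝟙-mono (f i) (g i) (h i))
  where
  𝟙-mono : ∀ a b → (T a → T b) → 𝟙 a ≤ 𝟙 b
  𝟙-mono false b _ = z≤n
  𝟙-mono true true _ = ≤-refl
  𝟙-mono true false t = ⊥-elim (t tt)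

count-split : ∀ {n} (f g : Fin n → Bool) → count f ≡ count (λ i → f i ∧ g i) + count (λ i → f i ∧ not (g i))
count-split f g = trans (sum-cong-≗ (λ i → 𝟙-split (f i) (g i))) (∑-distrib-+ (λ i → 𝟙 (f i ∧ g i)) (λ i → 𝟙 (f i ∧ not (g i))))
  where
  𝟙-split : ∀ a b → 𝟙 a ≡ 𝟙 (a ∧ b) + 𝟙 (a ∧ not b)
  𝟙-split false b = refl
  𝟙-split true true = refl
  𝟙-split true false = refl

count-disjoint-≤ : ∀ {n} {f g h : Fin n → Bool} → (∀ i → T (f i) → T (g i) → ⊥) →
                   (∀ i → T (f i) → T (h i)) → (∀ i → T (g i) → T (h i)) → count f + count g ≤ count h
count-disjoint-≤ {f = f} {g} {h} disj f⊆h g⊆h =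
  subst (_≤ count h) (∑-distrib-+ (𝟙 ∘ f) (𝟙 ∘ g)) (sum-mono-≤ (λ i → 𝟙-disj (f i) (g i) (h i) (disj i) (f⊆h i) (g⊆h i)))
  where
  𝟙-disj : ∀ x y z → (T x → T y → ⊥) → (T x → T z) → (T y → T z) → 𝟙 x + 𝟙 y ≤ 𝟙 z
  𝟙-disj false false z _ _ _ = z≤n
  𝟙-disj true true z d _ _ = ⊥-elim (d tt tt)
  𝟙-disj true false true _ _ _ = ≤-refl
  𝟙-disj true false false _ a _ = ⊥-elim (a tt)
  𝟙-disj false true true _ _ _ = ≤-refl
  𝟙-disj false true false _ _ b = ⊥-elim (b tt)

count-remove : ∀ {n} (f : Fin n → Bool) (x : Fin n) → T (f x) → count f ≡ suc (count (λ i → f i ∧ not ⌊ i ≟ x ⌋))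
count-remove f x fx =
  trans (count-split f (λ i → ⌊ i ≟ x ⌋))
        (cong (_+ count (λ i → f i ∧ not ⌊ i ≟ x ⌋)) (trans (sum-cong-≗ only-x) (count-singleton x)))
  where
  only-x : ∀ i → 𝟙 (f i ∧ ⌊ i ≟ x ⌋) ≡ 𝟙 ⌊ i ≟ x ⌋
  only-x i with i ≟ x
  ... | yes refl rewrite T⇒≡true fx = refl
  ... | no _ with f i
  ...   | true = refl
  ...   | false = refl

injection≤count : ∀ {n} k (g : Fin k → Fin n) (f : Fin n → Bool) →
                  (∀ i j → g i ≡ g j → i ≡ j) → (∀ j → T (f (g j))) → k ≤ count f
injection≤count zero g f inj h = z≤n
injection≤count (suc k) g f inj h =
  subst (suc k ≤_) (sym (count-remove f (g fzero) (h fzero)))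
    (s≤s (injection≤count k (g ∘ fsuc) _ (λ i j e → fsuc-injective (inj _ _ e))
                          (λ j → T-∧-intro (h (fsuc j)) (T-not-intro (g-fsuc≢g-fzero j ∘ T-≟⇒≡)))))
  where
  fsuc-injective : ∀ {i j : Fin k} → fsuc i ≡ fsuc j → i ≡ j
  fsuc-injective refl = refl
  g-fsuc≢g-fzero : ∀ j → g (fsuc j) ≢ g fzero
  g-fsuc≢g-fzero j e with inj _ _ e
  ... | ()

count-below : ∀ n k → k ≤ n → count {n} (λ v → toℕ v <ᵇ k) ≡ k
count-below n zero _ = count-false n
count-below (suc n) (suc k) (s≤s k≤n) = cong suc (count-below n k k≤n)

∣tabulate∣≡count : ∀ {n} (f : Fin n → Bool) → ∣ tabulate f ∣ ≡ count f
∣tabulate∣≡count {zero} f = refl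
∣tabulate∣≡count {suc n} f with f fzero
... | true = cong suc (∣tabulate∣≡count (f ∘ fsuc))
... | false = ∣tabulate∣≡count (f ∘ fsuc)

∣p∣≡count-lookup : ∀ {n} (p : Subset n) → ∣ p ∣ ≡ count (lookup p)
∣p∣≡count-lookup [] = refl
∣p∣≡count-lookup (true ∷ p) = cong suc (∣p∣≡count-lookup p)
∣p∣≡count-lookup (false ∷ p) = ∣p∣≡count-lookup p

∈-tabulate⁻ : ∀ {n} {f : Fin n → Bool} {x} → x ∈ tabulate f → T (f x)
∈-tabulate⁻ {f = f} {x} p = subst T (trans (sym ([]=⇒lookup p)) (lookup∘tabulate f x)) tt

∈-tabulate⁺ : ∀ {n} {f : Fin n → Bool} {x} → T (f x) → x ∈ tabulate f
∈-tabulate⁺ {f = f} {x} t = lookup⇒[]= x (tabulate f) (trans (lookup∘tabulate f x) (T⇒≡true t))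

∈⇒T-lookup : ∀ {n} {p : Subset n} {x} → x ∈ p → T (lookup p x)
∈⇒T-lookup x∈p = subst T (sym ([]=⇒lookup x∈p)) tt

T-lookup⇒∈ : ∀ {n} {p : Subset n} {x} → T (lookup p x) → x ∈ p
T-lookup⇒∈ {p = p} {x} t = lookup⇒[]= x p (T⇒≡true t)

_∈?_ : ∀ {n} x (p : Subset n) → Dec (x ∈ p)
x ∈? p with T? (lookup p x)
... | yes t = yes (T-lookup⇒∈ t)
... | no nt = no (nt ∘ ∈⇒T-lookup)

x∉p-x : ∀ {n} (p : Subset n) x → x ∉ p - x
x∉p-x (_ ∷ p) fzero ()
x∉p-x (_ ∷ p) (fsuc x) (there x∈p-x) = x∉p-x p x x∈p-x

-- Graphs, walks and induced paths

Adj-stable : ∀ {n} {G : Graph n} {x y} → DoubleNegation (Adj G x y) → Adj G x y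
Adj-stable {G = G} {x} {y} = decidable-stable (T? (adj G x y))

¬Adjᶜ⇒Adj : ∀ {n} (G : Graph n) {u v} → u ≢ v → ¬ Adj (complement G) u v → Adj G u v
¬Adjᶜ⇒Adj G {u} {v} u≢v u≁ᶜv with u ≟ v
... | yes u≡v = ⊥-elim (u≢v u≡v)
... | no _ with adj G u v
...   | true = tt
...   | false = u≁ᶜv tt

Adjᶜ⇒¬Adj : ∀ {n} (G : Graph n) {u v} → Adj (complement G) u v → ¬ Adj G u v
Adjᶜ⇒¬Adj G {u} {v} u~ᶜv u~v with u ≟ v
... | yes _ = u~ᶜv
... | no _ with adj G u v
...   | true = u~ᶜv
...   | false = u~v

Adjᶜ-irrefl : ∀ {n} (G : Graph n) {v} → ¬ Adj (complement G) v v
Adjᶜ-irrefl G {v} v~ᶜv with v ≟ v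
... | yes _ = v~ᶜv
... | no v≢v = v≢v refl

Adjᶜ-sym : ∀ {n} (G : Graph n) → (∀ u v → Adj G u v → Adj G v u) → ∀ {u v} → Adj (complement G) u v → Adj (complement G) v u
Adjᶜ-sym G symA {u} {v} u~ᶜv with u ≟ v | v ≟ u
... | yes _ | _ = ⊥-elim u~ᶜv
... | no u≢v | yes v≡u = ⊥-elim (u≢v (sym v≡u))
... | no _ | no _ = T-not-intro (T-not-elim u~ᶜv ∘ symA _ _)

reach-source-∉ : ∀ {n} {G : Graph n} {W : Subset n} {u v} → Reach G W u v → u ∉ W
reach-source-∉ (here u∉W) = u∉W
reach-source-∉ (step u∉W _ _) = u∉W

reach-trans : ∀ {n} {G : Graph n} {W : Subset n} {u v w} → Reach G W u v → Reach G W v w → Reach G W u w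
reach-trans (here _) r = r
reach-trans (step p a r₁) r = step p a (reach-trans r₁ r)

module Walks {n : ℕ} (G : Graph n) where

  -- A walk of length len inside R; the vertex function is total on ℕ and only matters up to len.
  record Walk (R : Fin n → Set) : Set where
    field
      len : ℕ
      at : ℕ → Fin n
      edge : ∀ i → i < len → Adj G (at i) (at (suc i))
      within : ∀ i → i ≤ len → R (at i)
  open Walk public

  end : ∀ {R} → Walk R → Fin n
  end w = at w (len w)

  restrict : ∀ {R R' : Fin n → Set} (w : Walk R) → (∀ i → i ≤ len w → R' (at w i)) → Walk R'
  restrict w h = record { len = len w ; at = at w ; edge = edge w ; within = h }

  trivial : ∀ {R} v → R v → Walk R
  trivial v r = record { len = 0 ; at = λ _ → v ; edge = λ i () ; within = λ _ _ → r }

  take : ∀ {R} (w : Walk R) i → i ≤ len w → Walk R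
  take w i le = record { len = i ; at = at w ; edge = λ k k<i → edge w k (<-≤-trans k<i le) ; within = λ k k≤i → within w k (≤-trans k≤i le) }

  drop : ∀ {R} (w : Walk R) i → i ≤ len w → Walk R
  drop w i le = record { len = len w ∸ i ; at = λ k → at w (i + k)
    ; edge = λ k k< → subst (λ z → Adj G (at w (i + k)) (at w z)) (sym (+-suc i k)) (edge w (i + k) (sh k k<))
    ; within = λ k k≤ → within w (i + k) (sh2 k k≤) }
    where
    sh : ∀ k → k < len w ∸ i → i + k < len w
    sh k p = subst (i + k <_) (m+[n∸m]≡n le) (+-monoʳ-< i p)
    sh2 : ∀ k → k ≤ len w ∸ i → i + k ≤ len w
    sh2 k p = subst (i + k ≤_) (m+[n∸m]≡n le) (+-monoʳ-≤ i p)

  drop-end : ∀ {R} (w : Walk R) i (le : i ≤ len w) → end (drop w i le) ≡ end w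
  drop-end w i le = cong (at w) (m+[n∸m]≡n le)

  snoc : ∀ {R} (w : Walk R) v → Adj G (end w) v → R v → Walk R
  snoc {R} w v a r = record { len = suc (len w) ; at = p ; edge = st ; within = ir }
    where
    p : ℕ → Fin n
    p k = if k ≤ᵇ len w then at w k else v
    st : ∀ i → i < suc (len w) → Adj G (p i) (p (suc i))
    st i (s≤s i≤l) with m≤n⇒m<n∨m≡n i≤l
    ... | inj₁ i<l = subst₂ (Adj G) (sym (if-≤ᵇ-yes i≤l)) (sym (if-≤ᵇ-yes i<l)) (edge w i i<l)
    ... | inj₂ refl = subst₂ (Adj G) (sym (if-≤ᵇ-yes {i = len w} ≤-refl)) (sym (if-≤ᵇ-no {i = suc (len w)} ≤-refl)) a
    ir : ∀ i → i ≤ suc (len w) → R (p i)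
    ir i le with i ≤? len w
    ... | yes i≤l = subst R (sym (if-≤ᵇ-yes i≤l)) (within w i i≤l)
    ... | no i≰l = subst R (sym (if-≤ᵇ-no (≰⇒> i≰l))) r

  snoc-end : ∀ {R} (w : Walk R) v a r → end (snoc w v a r) ≡ v
  snoc-end w v a r = if-≤ᵇ-no {i = suc (len w)} ≤-refl

  module Reverse (symA : ∀ u v → Adj G u v → Adj G v u) where
    reverse : ∀ {R} (w : Walk R) → Walk R
    reverse w = record { len = len w ; at = λ k → at w (len w ∸ k)
      ; edge = λ k k< → symA _ _
          (subst (λ z → Adj G (at w (len w ∸ suc k)) (at w z)) (e k k<) (edge w (len w ∸ suc k) (∸-monoʳ-< {len w} {suc k} {0} (s≤s z≤n) k<)))
      ; within = λ k _ → within w (len w ∸ k) (m∸n≤m _ k) }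
      where
      e : ∀ k → k < len w → suc (len w ∸ suc k) ≡ len w ∸ k
      e k k< = sym (+-∸-assoc 1 k<)
    reverse-end : ∀ {R} (w : Walk R) → end (reverse w) ≡ at w 0
    reverse-end w = cong (at w) (n∸n≡0 (len w))

  appendAt : ∀ {R} (w₁ w₂ : Walk R) → ℕ → Fin n
  appendAt w₁ w₂ k = if k ≤ᵇ len w₁ then at w₁ k else at w₂ (k ∸ len w₁)

  appendAt-right : ∀ {R} (w₁ w₂ : Walk R) → end w₁ ≡ at w₂ 0 → ∀ k → len w₁ ≤ k → appendAt w₁ w₂ k ≡ at w₂ (k ∸ len w₁)
  appendAt-right w₁ w₂ e k le with m≤n⇒m<n∨m≡n le
  ... | inj₁ l<k = if-≤ᵇ-no l<k
  ... | inj₂ refl = trans (if-≤ᵇ-yes {i = len w₁} ≤-refl) (trans e (cong (at w₂) (sym (n∸n≡0 (len w₁)))))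

  append : ∀ {R} (w₁ w₂ : Walk R) → end w₁ ≡ at w₂ 0 → Walk R
  append {R} w₁ w₂ e = record { len = len w₁ + len w₂ ; at = p ; edge = st ; within = ir }
    where
    l = len w₁
    p : ℕ → Fin n
    p = appendAt w₁ w₂
    p-hi : ∀ k → l ≤ k → p k ≡ at w₂ (k ∸ l)
    p-hi = appendAt-right w₁ w₂ e
    st : ∀ i → i < l + len w₂ → Adj G (p i) (p (suc i))
    st i i< with suc i ≤? l
    ... | yes si≤l = subst₂ (Adj G) (sym (if-≤ᵇ-yes (<⇒≤ si≤l))) (sym (if-≤ᵇ-yes si≤l)) (edge w₁ i si≤l)
    ... | no si≰l = subst₂ (Adj G) (sym (p-hi i l≤i)) (sym (p-hi (suc i) (≤-trans l≤i (n≤1+n i))))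
                     (subst (λ z → Adj G (at w₂ (i ∸ l)) (at w₂ z)) (sym (+-∸-assoc 1 l≤i)) (edge w₂ (i ∸ l) lt))
      where
      l≤i : l ≤ i
      l≤i = ≤-pred (≰⇒> si≰l)
      lt : i ∸ l < len w₂
      lt = subst (i ∸ l <_) (m+n∸m≡n l (len w₂)) (∸-monoˡ-< i< l≤i)
    ir : ∀ i → i ≤ l + len w₂ → R (p i)
    ir i le with i ≤? l
    ... | yes i≤l = subst R (sym (if-≤ᵇ-yes i≤l)) (within w₁ i i≤l)
    ... | no i≰l = subst R (sym (p-hi i (<⇒≤ (≰⇒> i≰l)))) (within w₂ (i ∸ l) (subst (i ∸ l ≤_) (m+n∸m≡n l (len w₂)) (∸-monoˡ-≤ l le)))

  append-end : ∀ {R} (w₁ w₂ : Walk R) e → end (append w₁ w₂ e) ≡ end w₂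
  append-end w₁ w₂ e = trans (appendAt-right w₁ w₂ e (len w₁ + len w₂) (m≤m+n _ _)) (cong (at w₂) (m+n∸m≡n (len w₁) (len w₂)))

  shortcut : ∀ {R} (w : Walk R) i j → i < j → j ≤ len w → Adj G (at w i) (at w j) → Walk R
  shortcut {R} w i j i<j j≤ a = record { len = len w ∸ d ; at = p ; edge = st ; within = ir }
    where
    d = j ∸ suc i
    p : ℕ → Fin n
    p k = if k ≤ᵇ i then at w k else at w (k + d)
    d≤ : d ≤ len w
    d≤ = ≤-trans (m∸n≤m j (suc i)) j≤
    st : ∀ k → k < len w ∸ d → Adj G (p k) (p (suc k))
    st k k< with suc k ≤? i
    ... | yes sk≤i = subst₂ (Adj G) (sym (if-≤ᵇ-yes (<⇒≤ sk≤i))) (sym (if-≤ᵇ-yes sk≤i)) (edge w k (<-≤-trans sk≤i (<⇒≤ (<-≤-trans i<j j≤))))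
    ... | no sk≰i with k ≤? i
    ...   | yes k≤i = subst₂ (Adj G) (sym (if-≤ᵇ-yes k≤i)) (sym (if-≤ᵇ-no (≰⇒> sk≰i))) (subst₂ (λ x y → Adj G (at w x) (at w y)) (sym k≡i) (sym e) a)
      where
      k≡i : k ≡ i
      k≡i = ≤-antisym k≤i (≤-pred (≰⇒> sk≰i))
      e : suc k + d ≡ j
      e = trans (cong (λ z → suc z + d) k≡i) (m+[n∸m]≡n i<j)
    ...   | no k≰i = subst₂ (Adj G) (sym (if-≤ᵇ-no (≰⇒> k≰i))) (sym (if-≤ᵇ-no (≰⇒> sk≰i))) (edge w (k + d) lt)
      where
      lt : k + d < len w
      lt = subst (k + d <_) (m∸n+n≡m d≤) (+-monoˡ-< d k<)
    ir : ∀ k → k ≤ len w ∸ d → R (p k)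
    ir k k≤ with k ≤? i
    ... | yes k≤i = subst R (sym (if-≤ᵇ-yes k≤i)) (within w k (≤-trans k≤i (<⇒≤ (<-≤-trans i<j j≤))))
    ... | no k≰i = subst R (sym (if-≤ᵇ-no (≰⇒> k≰i))) (within w (k + d) (subst (k + d ≤_) (m∸n+n≡m d≤) (+-monoˡ-≤ d k≤)))

  shortcut-len : ∀ {R} (w : Walk R) i j i<j j≤ a → suc i < j → len (shortcut w i j i<j j≤ a) < len w
  shortcut-len w i j i<j j≤ a si<j = ∸-monoʳ-< {len w} {j ∸ suc i} {0} (m<n⇒0<n∸m si<j) (≤-trans (m∸n≤m j (suc i)) j≤)

  shortcut-end : ∀ {R} (w : Walk R) i j i<j j≤ a → end (shortcut w i j i<j j≤ a) ≡ end w
  shortcut-end w i j i<j j≤ a = trans (if-≤ᵇ-no gt) (cong (at w) (m∸n+n≡m d≤))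
    where
    d = j ∸ suc i
    d≤ : d ≤ len w
    d≤ = ≤-trans (m∸n≤m j (suc i)) j≤
    gt : i < len w ∸ d
    gt = subst (_≤ len w ∸ d) (m+n∸n≡m (suc i) d) (∸-monoˡ-≤ d (subst (_≤ len w) (sym (m+[n∸m]≡n i<j)) j≤))

module InducedPaths {n : ℕ} (G : Graph n) where
  open Walks G

  record InducedPath (R A B : Fin n → Set) : Set where
    field
      walk : Walk R
      starts-in : A (at walk 0)
      ends-in : B (end walk)
      B-only-at-end : ∀ i → i < len walk → ¬ B (at walk i)
      A-only-at-start : ∀ i → 0 < i → i ≤ len walk → ¬ A (at walk i)
      distinct : ∀ i j → i < j → j ≤ len walk → at walk i ≢ at walk j
      chordless : ∀ i j → suc i < j → j ≤ len walk → ¬ Adj G (at walk i) (at walk j)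

  ¬¬-induced-path : ∀ {R A B : Fin n → Set} (w : Walk R) → A (at w 0) → B (end w) → DoubleNegation (InducedPath R A B)
  ¬¬-induced-path w = shorten (len w) w ≤-refl
    where
    shorten : ∀ {R A B : Fin n → Set} N (w : Walk R) → len w ≤ N → A (at w 0) → B (end w) → DoubleNegation (InducedPath R A B)
    shorten {R} {A} {B} N w len≤N a b = do
      no ∄early-B ← ¬¬-excluded-middle {A = Σ ℕ λ i → i < len w × B (at w i)}
        where yes (i , i<ℓ , bi) → recurse (take w i (<⇒≤ i<ℓ)) i<ℓ a bi
      no ∄late-A ← ¬¬-excluded-middle {A = Σ ℕ λ i → 0 < i × i ≤ len w × A (at w i)}
        where yes (i , 0<i , i≤ℓ , ai) → recurse (drop w i i≤ℓ) (∸-monoʳ-< {len w} {i} {0} 0<i i≤ℓ)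
                                                (subst A (sym (cong (at w) (+-identityʳ i))) ai) (subst B (sym (drop-end w i i≤ℓ)) b)
      no ∄chord ← ¬¬-excluded-middle {A = Σ ℕ λ i → Σ ℕ λ j → suc i < j × j ≤ len w × Adj G (at w i) (at w j)}
        where yes (i , j , 1+i<j , j≤ℓ , aij) → let i<j = <-trans (n<1+n i) 1+i<j in
                recurse (shortcut w i j i<j j≤ℓ aij) (shortcut-len w i j i<j j≤ℓ aij 1+i<j)
                        a (subst B (sym (shortcut-end w i j i<j j≤ℓ aij)) b)
      pure record
        { walk = w ; starts-in = a ; ends-in = b
        ; B-only-at-end = λ i i<ℓ bi → ∄early-B (i , i<ℓ , bi)
        ; A-only-at-start = λ i 0<i i≤ℓ ai → ∄late-A (i , 0<i , i≤ℓ , ai)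
        ; distinct = distinct ∄early-B ∄chord
        ; chordless = λ i j 1+i<j j≤ℓ aij → ∄chord (i , j , 1+i<j , j≤ℓ , aij) }
      where
      recurse : (w' : Walk R) → len w' < len w → A (at w' 0) → B (end w') → DoubleNegation (InducedPath R A B)
      recurse w' shorter = go N len≤N
        where
        go : ∀ M → len w ≤ M → A (at w' 0) → B (end w') → DoubleNegation (InducedPath R A B)
        go (suc M) len≤1+M = shorten M w' (≤-pred (<-≤-trans shorter len≤1+M))
        go zero len≤0 = ⊥-elim (n≮0 (<-≤-trans shorter len≤0))
      distinct : ¬ (Σ ℕ λ i → i < len w × B (at w i)) → ¬ (Σ ℕ λ i → Σ ℕ λ j → suc i < j × j ≤ len w × Adj G (at w i) (at w j))
               → ∀ i j → i < j → j ≤ len w → at w i ≢ at w j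
      distinct nV1 nV4 i j i<j j≤ e with m≤n⇒m<n∨m≡n j≤
      ... | inj₂ refl = nV1 (i , i<j , subst B (sym e) b)
      ... | inj₁ j< = nV4 (i , suc j , s≤s i<j , j< , subst (λ z → Adj G z (at w (suc j))) (sym e) (edge w j j<))

module Holes {n : ℕ} (G : Graph n) (symA : ∀ u v → Adj G u v → Adj G v u) (chG : Chordal G) where

  no-hole : (m : ℕ) → 2 ≤ m → (p : ℕ → Fin n) (a : Fin n) →
    (∀ i → i < m → Adj G (p i) (p (suc i))) →
    (∀ i j → i < j → j ≤ m → p i ≢ p j) →
    (∀ i → i ≤ m → p i ≢ a) →
    (∀ i j → suc i < j → j ≤ m → ¬ Adj G (p i) (p j)) →
    Adj G a (p 0) → Adj G a (p m) →
    (∀ i → 0 < i → i < m → ¬ Adj G a (p i)) → ⊥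
  no-hole m 2≤m p a path-edge path-distinct path-≢apex path-chordless a~start a~end interior-≁ = chordless-hole (chG hole)
    where
    cycle : ℕ → Fin n
    cycle k = if k ≤ᵇ m then p k else a
    cycle-path : ∀ k → k ≤ m → cycle k ≡ p k
    cycle-path k le = if-≤ᵇ-yes le
    cycle-apex : cycle (suc m) ≡ a
    cycle-apex = if-≤ᵇ-no {i = suc m} ≤-refl
    L = suc (suc m)
    index≤ : (i : Fin L) → toℕ i ≤ suc m
    index≤ i = ≤-pred (toℕ<n i)
    cycle-edge : ∀ x → x ≤ m → Adj G (cycle x) (cycle (suc x))
    cycle-edge x x≤ with m≤n⇒m<n∨m≡n x≤
    ... | inj₁ x<m = subst₂ (Adj G) (sym (cycle-path x x≤)) (sym (cycle-path (suc x) x<m)) (path-edge x x<m)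
    ... | inj₂ refl = subst₂ (Adj G) (sym (cycle-path x x≤)) (sym cycle-apex) (symA _ _ a~end)
    cycle-edges : ∀ (i j : Fin L) → CycNb L i j → Adj G (cycle (toℕ i)) (cycle (toℕ j))
    cycle-edges i j (inj₁ e) = subst (λ z → Adj G (cycle (toℕ i)) (cycle z)) e (cycle-edge (toℕ i) (≤-pred (subst (_≤ suc m) (sym e) (index≤ j))))
    cycle-edges i j (inj₂ (inj₁ e)) = symA _ _ (subst (λ z → Adj G (cycle (toℕ j)) (cycle z)) e (cycle-edge (toℕ j) (≤-pred (subst (_≤ suc m) (sym e) (index≤ i)))))
    cycle-edges i j (inj₂ (inj₂ (inj₁ (e0 , e)))) = subst₂ (λ x y → Adj G (cycle x) (cycle y)) (sym e0)
        (suc-injective (sym e)) (subst₂ (Adj G) (sym (cycle-path 0 z≤n)) (sym cycle-apex) (symA _ _ a~start))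
    cycle-edges i j (inj₂ (inj₂ (inj₂ (e0 , e)))) = subst₂ (λ x y → Adj G (cycle x) (cycle y)) (suc-injective (sym e))
        (sym e0) (subst₂ (Adj G) (sym cycle-apex) (sym (cycle-path 0 z≤n)) a~start)
    cycle-injective : ∀ x y → x ≤ suc m → y ≤ suc m → cycle x ≡ cycle y → x ≡ y
    cycle-injective x y x≤ y≤ e with m≤n⇒m<n∨m≡n x≤ | m≤n⇒m<n∨m≡n y≤
    ... | inj₂ refl | inj₂ refl = refl
    ... | inj₁ x< | inj₂ refl = ⊥-elim (path-≢apex x (≤-pred x<) (trans (sym (cycle-path x (≤-pred x<))) (trans e cycle-apex)))
    ... | inj₂ refl | inj₁ y< = ⊥-elim (path-≢apex y (≤-pred y<) (trans (sym (cycle-path y (≤-pred y<))) (trans (sym e) cycle-apex)))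
    ... | inj₁ x< | inj₁ y< with <-cmp x y
    ...   | tri≈ _ eq _ = eq
    ...   | tri< lt _ _ = ⊥-elim (path-distinct x y lt (≤-pred y<) (trans (sym (cycle-path x (≤-pred x<))) (trans e (cycle-path y (≤-pred y<)))))
    ...   | tri> _ _ gt = ⊥-elim (path-distinct y x gt (≤-pred x<) (trans (sym (cycle-path y (≤-pred y<))) (trans (sym e) (cycle-path x (≤-pred x<)))))
    interior : ∀ z → z ≤ m → z ≢ 0 → z ≢ m → Adj G a (p z) → ⊥
    interior z z≤ z0 zm ad' = interior-≁ z (n≢0⇒n>0 z0) (≤∧≢⇒< z≤ zm) ad'
    not-chord : ∀ x y → x ≤ suc m → y ≤ suc m → x ≢ y → suc x ≢ y → suc y ≢ x → ¬ (x ≡ 0 × y ≡ suc m) → ¬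
        (y ≡ 0 × x ≡ suc m) → Adj G (cycle x) (cycle y) → ⊥
    not-chord x y x≤ y≤ ne n1 n2 n3 n4 ad with m≤n⇒m<n∨m≡n x≤ | m≤n⇒m<n∨m≡n y≤
    ... | inj₂ refl | inj₂ refl = ne refl
    ... | inj₁ x< | inj₂ refl = interior x (≤-pred x<) (λ e → n3 (e , refl)) (λ e → n1 (cong suc e))
        (symA _ _ (subst₂ (Adj G) (cycle-path x (≤-pred x<)) cycle-apex ad))
    ... | inj₂ refl | inj₁ y< = interior y (≤-pred y<) (λ e → n4 (e , refl)) (λ e → n2 (cong suc e))
        (subst₂ (Adj G) cycle-apex (cycle-path y (≤-pred y<)) ad)
    ... | inj₁ x< | inj₁ y< with <-cmp x y
    ...   | tri≈ _ eq _ = ne eq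
    ...   | tri< lt _ _ = path-chordless x y (≤∧≢⇒< lt n1) (≤-pred y<) (subst₂ (Adj G) (cycle-path x (≤-pred x<)) (cycle-path y (≤-pred y<)) ad)
    ...   | tri> _ _ gt = path-chordless y x (≤∧≢⇒< gt n2) (≤-pred x<) (symA _ _ (subst₂ (Adj G) (cycle-path x (≤-pred x<)) (cycle-path y (≤-pred y<)) ad))
    hole : Cycle≥4 G
    hole = record { len = L ; len≥4 = s≤s (s≤s 2≤m) ; vert = λ i → cycle (toℕ i)
      ; inj = λ i j e → toℕ-injective (cycle-injective (toℕ i) (toℕ j) (index≤ i) (index≤ j) e)
      ; edges = cycle-edges }
    chordless-hole : HasChord hole → ⊥
    chordless-hole (i , j , i≢j , ncyc , ad) = not-chord (toℕ i) (toℕ j) (index≤ i) (index≤ j)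
      (λ e → i≢j (toℕ-injective e)) (λ e → ncyc (inj₁ e)) (λ e → ncyc (inj₂ (inj₁ e)))
      (λ { (e0 , e) → ncyc (inj₂ (inj₂ (inj₁ (e0 , cong suc e)))) })
      (λ { (e0 , e) → ncyc (inj₂ (inj₂ (inj₂ (e0 , cong suc e)))) }) ad

module Component {n : ℕ} (G : Graph n) (symA : ∀ u v → Adj G u v → Adj G v u)
             (X : Fin n → Set) (z : Fin n) (Xz : X z) where
  open Walks G
  open Walks.Reverse G symA

  Comp : Fin n → Set
  Comp v = Σ (Walk X) λ w → at w 0 ≡ z × end w ≡ v

  comp-within : ∀ {v} → Comp v → X v
  comp-within (w , _ , e) = subst X e (within w (len w) ≤-refl)

  comp-root : Comp z
  comp-root = trivial z Xz , refl , refl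

  comp-walk : (w : Walk X) → at w 0 ≡ z → ∀ i → i ≤ len w → Comp (at w i)
  comp-walk w e i le = take w i le , e , refl

  comp-extend : ∀ {u v} → Comp u → Adj G u v → X v → Comp v
  comp-extend {u} {v} (w , e0 , e) a xv = snoc w v a' xv , e0 , snoc-end w v a' xv
    where
    a' : Adj G (end w) v
    a' = subst (λ t → Adj G t v) (sym e) a

  comp-connect : ∀ {u v} → Comp u → Comp v → Σ (Walk Comp) λ w → at w 0 ≡ u × end w ≡ v
  comp-connect {u} {v} (wu , eu0 , eu) (wv , ev0 , ev) = W , eu , trans (append-end (reverse wu') wv' e) ev
    where
    wu' : Walk Comp
    wu' = restrict wu (comp-walk wu eu0)
    wv' : Walk Comp
    wv' = restrict wv (comp-walk wv ev0)
    e : end (reverse wu') ≡ at wv' 0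
    e = trans (reverse-end wu') (trans eu0 (sym ev0))
    W = append (reverse wu') wv' e

-- Maximal cliques and the bound κ(G) + τmax(Gᶜ) ≤ n − 1

module CliqueComponent {n : ℕ} (G : Graph n) (symA : ∀ u v → Adj G u v → Adj G v u) (chG : Chordal G)
    (Q : Fin n → Set) (Q-clique : ∀ u v → Q u → Q v → u ≢ v → Adj G u v) (z : Fin n) (z∉Q : ¬ Q z) where
  open Walks G
  open InducedPaths G
  open Holes G symA chG
  open Component G symA (¬_ ∘ Q) z z∉Q public

  -- Otherwise the last neighbour of q' on the path, the rest of the path, q and q' form a hole.
  adjacent-to-end : ∀ {A : Fin n → Set} {q q'} → Q q → Q q' → q' ≢ q → (o : InducedPath Comp A (Adj G q)) →
                    Adj G q' (at (InducedPath.walk o) 0) → Adj G q' (end (InducedPath.walk o))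
  adjacent-to-end {A} {q} {q'} Qq Qq' q'≢q o q'~start with T? (adj G q' (end (InducedPath.walk o)))
  ... | yes q'~end = q'~end
  ... | no q'≁end = ⊥-elim (no-hole M 2≤M path q' path-edge path-distinct path-≢apex path-chordless
                             (subst (Adj G q') (sym (trans (path-low 0 z≤n) (cong p (+-identityʳ i)))) q'~pᵢ)
                             (subst (Adj G q') (sym path-top) (Q-clique q' q Qq' Qq q'≢q))
                             interior-≁)
    where
    open InducedPath o
    p = at walk
    m = len walk
    last = greatest-below (λ i → Adj G q' (p i)) (λ i → T? (adj G q' (p i))) q'~start m
    i = proj₁ last
    i≤m = proj₁ (proj₂ last)
    q'~pᵢ = proj₁ (proj₂ (proj₂ last))
    q'≁after-i = proj₂ (proj₂ (proj₂ last))
    i<m : i < m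
    i<m with m≤n⇒m<n∨m≡n i≤m
    ... | inj₁ lt = lt
    ... | inj₂ i≡m = ⊥-elim (q'≁end (subst (λ t → Adj G q' (p t)) i≡m q'~pᵢ))
    d = m ∸ i
    M = suc d
    path : ℕ → Fin n
    path t = if t ≤ᵇ d then p (i + t) else q
    path-low : ∀ t → t ≤ d → path t ≡ p (i + t)
    path-low t t≤d = if-≤ᵇ-yes t≤d
    path-top : path M ≡ q
    path-top = if-≤ᵇ-no {i = M} ≤-refl
    shift-≤ : ∀ {t} → t ≤ d → i + t ≤ m
    shift-≤ {t} t≤d = subst (i + t ≤_) (m+[n∸m]≡n (<⇒≤ i<m)) (+-monoʳ-≤ i t≤d)
    shift-< : ∀ {t} → t < d → i + t < m
    shift-< {t} t<d = subst (i + t <_) (m+[n∸m]≡n (<⇒≤ i<m)) (+-monoʳ-< i t<d)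
    path-∉Q : ∀ t → t ≤ d → ¬ Q (path t)
    path-∉Q t t≤d = subst (¬_ ∘ Q) (sym (path-low t t≤d)) (comp-within (within walk (i + t) (shift-≤ t≤d)))
    low-or-top : ∀ t → t ≤ M → (t ≤ d) ⊎ (t ≡ M)
    low-or-top t t≤M with m≤n⇒m<n∨m≡n t≤M
    ... | inj₁ lt = inj₁ (≤-pred lt)
    ... | inj₂ e = inj₂ e
    2≤M : 2 ≤ M
    2≤M = s≤s (m<n⇒0<n∸m i<m)
    path-edge : ∀ t → t < M → Adj G (path t) (path (suc t))
    path-edge t t<M with m≤n⇒m<n∨m≡n (≤-pred t<M)
    ... | inj₁ t<d = subst₂ (Adj G) (sym (path-low t (<⇒≤ t<d))) (sym (path-low (suc t) t<d))
                       (subst (λ s → Adj G (p (i + t)) (p s)) (sym (+-suc i t)) (edge walk (i + t) (shift-< t<d)))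
    ... | inj₂ refl = subst₂ (Adj G) (sym (trans (path-low d ≤-refl) (cong p (m+[n∸m]≡n (<⇒≤ i<m))))) (sym path-top) (symA _ _ ends-in)
    path-distinct : ∀ s t → s < t → t ≤ M → path s ≢ path t
    path-distinct s t s<t t≤M e with low-or-top t t≤M
    ... | inj₁ t≤d = distinct (i + s) (i + t) (+-monoʳ-< i s<t) (shift-≤ t≤d)
                       (trans (sym (path-low s (<⇒≤ (<-≤-trans s<t t≤d)))) (trans e (path-low t t≤d)))
    ... | inj₂ refl = path-∉Q s (≤-pred s<t) (subst Q (sym (trans e path-top)) Qq)
    path-≢apex : ∀ t → t ≤ M → path t ≢ q'
    path-≢apex t t≤M e with low-or-top t t≤M
    ... | inj₁ t≤d = path-∉Q t t≤d (subst Q (sym e) Qq')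
    ... | inj₂ refl = q'≢q (sym (trans (sym path-top) e))
    path-chordless : ∀ s t → suc s < t → t ≤ M → ¬ Adj G (path s) (path t)
    path-chordless s t 1+s<t t≤M adj with low-or-top t t≤M
    ... | inj₁ t≤d = chordless (i + s) (i + t) (subst (_< i + t) (+-suc i s) (+-monoʳ-< i 1+s<t)) (shift-≤ t≤d)
                       (subst₂ (Adj G) (path-low s (<⇒≤ (<-≤-trans (<-trans (n<1+n s) 1+s<t) t≤d))) (path-low t t≤d) adj)
    ... | inj₂ refl = B-only-at-end (i + s) (shift-< (≤-pred 1+s<t))
                        (symA _ _ (subst₂ (Adj G) (path-low s (<⇒≤ (≤-pred 1+s<t))) path-top adj))
    interior-≁ : ∀ t → 0 < t → t < M → ¬ Adj G q' (path t)
    interior-≁ t 0<t t<M adj = q'≁after-i (i + t) (subst (_< i + t) (+-identityʳ i) (+-monoʳ-< i 0<t)) (shift-≤ (≤-pred t<M))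
                                 (subst (Adj G q') (path-low t (≤-pred t<M)) adj)

  module _ (has-neighbour : ∀ q → Q q → Σ (Fin n) λ c → Comp c × Adj G q c) where

    ¬¬-common-neighbour : ∀ j → j ≤ n → DoubleNegation (Σ (Fin n) λ c → Comp c × (∀ q → Q q → toℕ q < j → Adj G q c))
    ¬¬-common-neighbour zero _ = pure (z , comp-root , λ _ _ ())
    ¬¬-common-neighbour (suc j) 1+j≤n = do
      (a , Ca , a~Q<j) ← ¬¬-common-neighbour j (≤-trans (n≤1+n j) 1+j≤n)
      yes Qqʲ ← ¬¬-excluded-middle {A = Q qʲ}
        where no ¬Qqʲ → pure (a , Ca , extend a~Q<j (λ Qqʲ → ⊥-elim (¬Qqʲ Qqʲ)))
      (b , Cb , qʲ~b) ← pure (has-neighbour qʲ Qqʲ)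
      (W , W-start , W-end) ← pure (comp-connect Ca Cb)
      o ← ¬¬-induced-path {A = Below-j} W (subst Below-j (sym W-start) a~Q<j) (subst (Adj G qʲ) (sym W-end) qʲ~b)
      let open InducedPath o
      pure (end walk , within walk (len walk) ≤-refl ,
            extend (λ q Qq q<j → adjacent-to-end Qqʲ Qq (fresh q<j) o (starts-in q Qq q<j)) (λ _ → ends-in))
      where
      qʲ : Fin n
      qʲ = fromℕ< 1+j≤n
      Below-j : Fin n → Set
      Below-j c = ∀ q → Q q → toℕ q < j → Adj G q c
      fresh : ∀ {q} → toℕ q < j → q ≢ qʲ
      fresh q<j refl = <-irrefl (toℕ-fromℕ< 1+j≤n) q<j
      extend : ∀ {c} → Below-j c → (Q qʲ → Adj G qʲ c) → ∀ q → Q q → toℕ q < suc j → Adj G q c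
      extend {c} below qʲ~c q Qq q<1+j with m≤n⇒m<n∨m≡n (≤-pred q<1+j)
      ... | inj₁ q<j = below q Qq q<j
      ... | inj₂ q≡j = subst (λ v → Q v → Adj G v c) (sym (toℕ-injective (trans q≡j (sym (toℕ-fromℕ< 1+j≤n))))) qʲ~c Qq

  ¬¬-far-clique-vertex : (∀ v → ¬ Q v → Σ (Fin n) λ q → Q q × ¬ Adj G v q) →
                         DoubleNegation (Σ (Fin n) λ q → Q q × (∀ c → Comp c → ¬ Adj G q c))
  ¬¬-far-clique-vertex Q-maximal = do
    no ∄far ← ¬¬-excluded-middle
      where yes far → pure far
    has-neighbour ← ¬¬-choice (near ∄far)
    (c , Cc , c~Q) ← ¬¬-common-neighbour has-neighbour n ≤-refl
    (q , Qq , c≁q) ← pure (Q-maximal c (comp-within Cc))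
    ⊥-elim (c≁q (symA _ _ (c~Q q Qq (toℕ<n q))))
    where
    near : ¬ (Σ (Fin n) λ q → Q q × (∀ c → Comp c → ¬ Adj G q c)) →
           ∀ q → DoubleNegation (Q q → Σ (Fin n) λ c → Comp c × Adj G q c)
    near ∄far q = do
      yes nb ← ¬¬-excluded-middle
        where no ∄nb → pure λ Qq → ⊥-elim (∄far (q , Qq , λ c Cc q~c → ∄nb (c , Cc , q~c)))
      pure λ _ → nb

  reach⇒comp : (W : Subset n) (q : Fin n) → (∀ c → Comp c → ¬ Adj G q c) → (∀ v → Q v → v ≢ q → v ∈ W) →
               ∀ {u v} → Reach G W u v → Comp u → DoubleNegation (Comp v)
  reach⇒comp W q far Q∖q⊆W (here _) Cu = pure Cu
  reach⇒comp W q far Q∖q⊆W (step {u} {w} u∉W u~w r) Cu = do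
    yes Qw ← ¬¬-excluded-middle
      where no ¬Qw → reach⇒comp W q far Q∖q⊆W r (comp-extend Cu u~w ¬Qw)
    ⊥-elim (w∉Q Qw)
    where
    w∉Q : ¬ Q w
    w∉Q Qw with w ≟ q
    ... | yes refl = far u Cu (symA _ _ u~w)
    ... | no w≢q = reach-source-∉ r (Q∖q⊆W w Qw w≢q)

module CoverOfComplement {n : ℕ} (G : Graph n) (symA : ∀ u v → Adj G u v → Adj G v u)
    (C : Subset n) (C-minimal : MinimalVertexCover (complement G) C) where

  outside-clique : ∀ u v → u ∉ C → v ∉ C → u ≢ v → Adj G u v
  outside-clique u v u∉C v∉C u≢v = ¬Adjᶜ⇒Adj G u≢v (λ u~ᶜv → [ u∉C , v∉C ]′ (proj₁ C-minimal u v u~ᶜv))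

  -- Otherwise C - v would still cover the complement.
  outside-maximal : ∀ v → v ∈ C → Σ (Fin n) λ q → q ∉ C × ¬ Adj G v q
  outside-maximal v v∈C with any? (λ q → T? (not (lookup C q) ∧ not (adj G v q)))
  ... | yes (q , t) = q , T-not-elim (T-∧-fst t) ∘ ∈⇒T-lookup , T-not-elim (T-∧-snd {not (lookup C q)} t)
  ... | no ∄q = ⊥-elim (x∉p-x C v (proj₂ C-minimal (C - v) (p─q⊆p C ⁅ v ⁆) C-v-cover v∈C))
    where
    v~outside : ∀ b → b ∉ C → Adj G v b
    v~outside b b∉C = Adj-stable {G = G} λ v≁b →
      ∄q (b , T-∧-intro (T-not-intro (b∉C ∘ T-lookup⇒∈)) (T-not-intro v≁b))
    keep : ∀ a b → Adj (complement G) a b → a ∈ C → a ∈ C - v ⊎ b ∈ C - v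
    keep a b a~ᶜb a∈C with a ≟ v
    ... | no a≢v = inj₁ (x∈p∧x≢y⇒x∈p-y a∈C a≢v)
    ... | yes refl with b ∈? C
    ...   | no b∉C = ⊥-elim (Adjᶜ⇒¬Adj G a~ᶜb (v~outside b b∉C))
    ...   | yes b∈C = inj₂ (x∈p∧x≢y⇒x∈p-y b∈C λ { refl → Adjᶜ-irrefl G a~ᶜb })
    C-v-cover : VertexCover (complement G) (C - v)
    C-v-cover a b a~ᶜb with proj₁ C-minimal a b a~ᶜb
    ... | inj₁ a∈C = keep a b a~ᶜb a∈C
    ... | inj₂ b∈C = swap (keep b a (Adjᶜ-sym G symA a~ᶜb) b∈C)

  -- If C were empty, every vertex would be universal.
  nonempty : Fin n → ¬ (∃ λ x → Universal G x) → Σ (Fin n) (_∈ C)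
  nonempty v₀ no-universal with any? (_∈? C)
  ... | yes z∈C = z∈C
  ... | no ∄z = ⊥-elim (no-universal (v₀ , λ y y≢v₀ →
                  outside-clique v₀ y (λ v₀∈C → ∄z (v₀ , v₀∈C)) (λ y∈C → ∄z (y , y∈C)) (y≢v₀ ∘ sym)))

-- In a chordal graph, some vertex q of a maximal clique Q ≠ V has no neighbour in a component of G − Q,
-- so Q − q is a separator.
clique-separator : ∀ {n} (G : Graph n) → (∀ u v → Adj G u v → Adj G v u) → Chordal G →
                   (C : Subset n) → MinimalVertexCover (complement G) C → ∀ z → z ∈ C →
                   DoubleNegation (Σ (Subset n) λ W → Separating G W × ∣ W ∣ + ∣ C ∣ ≤ n ∸ 1)
clique-separator {n} G symA chG C C-minimal z z∈C = do
  (q , q∉C , far) ← ¬¬-far-clique-vertex (λ v ¬v∉C → outside-maximal v (decidable-stable (v ∈? C) ¬v∉C))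
  pure (∁ C - q , separating q q∉C far , size q q∉C)
  where
  open CoverOfComplement G symA C C-minimal
  open CliqueComponent G symA chG (_∉ C) outside-clique z (λ z∉C → z∉C z∈C)
  separating : ∀ q → q ∉ C → (∀ c → Comp c → ¬ Adj G q c) → Separating G (∁ C - q)
  separating q q∉C far =
    z , q , x∈p⇒x∉∁p z∈C ∘ p─q⊆p (∁ C) ⁅ q ⁆ , x∉p-x (∁ C) q ,
    λ z⇝q → reach⇒comp (∁ C - q) q far (λ v v∉C v≢q → x∈p∧x≢y⇒x∈p-y (x∉p⇒x∈∁p v∉C) v≢q) z⇝q comp-root
              (λ Cq → comp-within Cq q∉C)
  size : ∀ q → q ∉ C → ∣ ∁ C - q ∣ + ∣ C ∣ ≤ n ∸ 1
  size q q∉C = m+n≤o⇒m≤o∸n _ (begin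
    ∣ ∁ C - q ∣ + ∣ C ∣ + 1   ≡⟨ +-comm _ 1 ⟩
    suc ∣ ∁ C - q ∣ + ∣ C ∣   ≤⟨ +-monoˡ-≤ ∣ C ∣ (subst (suc ∣ ∁ C - q ∣ ≤_) (∣∁p∣≡n∸∣p∣ C) (x∈p⇒∣p-x∣<∣p∣ (x∉p⇒x∈∁p q∉C))) ⟩
    n ∸ ∣ C ∣ + ∣ C ∣         ≡⟨ m∸n+n≡m (∣p∣≤n C) ⟩
    n                         ∎)
    where open ≤-Reasoning

κ+τmax≤n-1 : ∀ {n} (G : Graph n) → Fin n → IsSimple G → Chordal* G →
             ∀ {k t} → IsConnectivity G k → IsTauMax (complement G) t → k + t ≤ n ∸ 1
κ+τmax≤n-1 G v₀ (symA , _) (chG , no-universal) (_ , κ-minimal) ((C , C-minimal , ∣C∣≡t) , _) = ≤-stable do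
  (W , W-separating , ∣W∣+∣C∣≤n-1) ← clique-separator G symA chG C C-minimal (proj₁ C-nonempty) (proj₂ C-nonempty)
  pure (≤-trans (+-mono-≤ (κ-minimal W W-separating) (≤-reflexive (sym ∣C∣≡t))) ∣W∣+∣C∣≤n-1)
  where
  C-nonempty = CoverOfComplement.nonempty G symA C C-minimal v₀ no-universal

-- Simplicial vertices and the bound κ(G) ≤ n − 1 − (c − 2)

module Simplicial {n : ℕ} (G : Graph n) (symA : ∀ u v → Adj G u v → Adj G v u) (chG : Chordal G) where
  open Walks G
  open InducedPaths G
  open Holes G symA chG

  SimplicialIn : (Fin n → Bool) → Fin n → Set
  SimplicialIn U y = ∀ v w → T (U v) → T (U w) → Adj G y v → Adj G y w → v ≢ w → Adj G v w

  SimplicialNonNeighbour : (Fin n → Bool) → Fin n → Set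
  SimplicialNonNeighbour U a = Σ (Fin n) λ y → T (U y) × y ≢ a × ¬ Adj G a y × SimplicialIn U y

  -- The component of b in U − N[a], and its boundary in U (which lies in N(a)).
  module Step (U : Fin n → Bool) (a b : Fin n) (Ub : T (U b)) (b≢a : b ≢ a) (a≁b : ¬ Adj G a b) where
    Far : Fin n → Set
    Far v = T (U v) × v ≢ a × ¬ Adj G a v

    open Component G symA Far b (Ub , b≢a , a≁b) public

    Boundary : Fin n → Set
    Boundary v = T (U v) × ¬ Comp v × Σ (Fin n) λ c → Comp c × Adj G c v

    Closure : Fin n → Set
    Closure v = Comp v ⊎ Boundary v

    boundary-≢a : ∀ {v} → Boundary v → v ≢ a
    boundary-≢a (_ , _ , c , Cc , c~a) refl = proj₂ (proj₂ (comp-within Cc)) (symA _ _ c~a)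

    boundary-adjacent : ∀ {v} → Boundary v → Adj G a v
    boundary-adjacent ∂v@(Uv , v∉C , c , Cc , c~v) = Adj-stable {G = G} λ a≁v → v∉C (comp-extend Cc c~v (Uv , boundary-≢a ∂v , a≁v))

    ¬¬-closure : ∀ {c v} → Comp c → T (U v) → Adj G c v → DoubleNegation (Closure v)
    ¬¬-closure {c} {v} Cc Uv c~v = do
      no v∉C ← ¬¬-excluded-middle
        where yes Cv → pure (inj₁ Cv)
      pure (inj₂ (Uv , v∉C , c , Cc , c~v))

    lift-simplicial : (U′ : Fin n → Bool) → (∀ v → Closure v → T (U′ v)) → ∀ y → Comp y → SimplicialIn U′ y → SimplicialNonNeighbour U a
    lift-simplicial U′ closure⊆U′ y Cy simplicial′ = y , Uy , y≢a , a≁y , simplicial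
      where
      Uy = proj₁ (comp-within Cy)
      y≢a = proj₁ (proj₂ (comp-within Cy))
      a≁y = proj₂ (proj₂ (comp-within Cy))
      simplicial : SimplicialIn U y
      simplicial v w Uv Uw y~v y~w v≢w = Adj-stable {G = G} do
        cl-v ← ¬¬-closure Cy Uv y~v
        cl-w ← ¬¬-closure Cy Uw y~w
        pure (simplicial′ v w (closure⊆U′ v cl-v) (closure⊆U′ w cl-w) y~v y~w v≢w)

    -- Otherwise s₁, an induced path through the component, s₂ and a would form a hole.
    boundary-clique : ∀ s₁ s₂ → Boundary s₁ → Boundary s₂ → s₁ ≢ s₂ → Adj G s₁ s₂
    boundary-clique s₁ s₂ ∂s₁@(_ , s₁∉C , c₁ , Cc₁ , c₁~s₁) ∂s₂@(_ , s₂∉C , c₂ , Cc₂ , c₂~s₂) s₁≢s₂ =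
      Adj-stable {G = G} λ s₁≁s₂ → ¬¬-induced-path {Comp} {Adj G s₁} {Adj G s₂} W
        (subst (Adj G s₁) (sym W-start) (symA _ _ c₁~s₁)) (subst (Adj G s₂) (sym W-end) (symA _ _ c₂~s₂))
        (λ o → close o s₁≁s₂)
      where
      connection = comp-connect Cc₁ Cc₂
      W = proj₁ connection
      W-start = proj₁ (proj₂ connection)
      W-end = proj₂ (proj₂ connection)
      close : InducedPath Comp (Adj G s₁) (Adj G s₂) → ¬ Adj G s₁ s₂ → ⊥
      close o s₁≁s₂ = no-hole M (s≤s (s≤s z≤n)) path a path-edge path-distinct path-≢a path-chordless
                        (boundary-adjacent ∂s₁) (subst (Adj G a) (sym path-top) (boundary-adjacent ∂s₂)) interior-≁
        where
        open InducedPath o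
        p = at walk
        m = len walk
        M = suc (suc m)
        path : ℕ → Fin n
        path zero = s₁
        path (suc t) = if t ≤ᵇ m then p t else s₂
        path-mid : ∀ t → t ≤ m → path (suc t) ≡ p t
        path-mid t t≤m = if-≤ᵇ-yes t≤m
        path-top : path M ≡ s₂
        path-top = if-≤ᵇ-no {i = suc m} ≤-refl
        on-walk : ∀ t → t ≤ m → Comp (p t)
        on-walk t t≤m = within walk t t≤m
        path-edge : ∀ t → t < M → Adj G (path t) (path (suc t))
        path-edge zero _ = subst (Adj G s₁) (sym (path-mid 0 z≤n)) starts-in
        path-edge (suc t) (s≤s t<1+m) with m≤n⇒m<n∨m≡n (≤-pred t<1+m)
        ... | inj₁ t<m = subst₂ (Adj G) (sym (path-mid t (<⇒≤ t<m))) (sym (path-mid (suc t) t<m)) (edge walk t t<m)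
        ... | inj₂ refl = subst₂ (Adj G) (sym (path-mid t ≤-refl)) (sym path-top) (symA _ _ ends-in)
        Position : ℕ → Set
        Position t = (t ≡ 0) ⊎ (Σ ℕ λ t' → t ≡ suc t' × t' ≤ m) ⊎ (t ≡ M)
        position : ∀ t → t ≤ M → Position t
        position zero _ = inj₁ refl
        position (suc t) t<M with m≤n⇒m<n∨m≡n t<M
        ... | inj₁ lt = inj₂ (inj₁ (t , refl , ≤-pred (≤-pred lt)))
        ... | inj₂ e = inj₂ (inj₂ e)
        path-distinct : ∀ s t → s < t → t ≤ M → path s ≢ path t
        path-distinct s t s<t t≤M e with position s (<⇒≤ (<-≤-trans s<t t≤M)) | position t t≤M
        ... | inj₁ refl | inj₁ refl = <-irrefl refl s<t
        ... | inj₁ refl | inj₂ (inj₁ (t' , refl , t'≤m)) = s₁∉C (subst Comp (sym (trans e (path-mid t' t'≤m))) (on-walk t' t'≤m))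
        ... | inj₁ refl | inj₂ (inj₂ refl) = s₁≢s₂ (trans e path-top)
        ... | inj₂ (inj₁ (s' , refl , s'≤m)) | inj₁ refl = ⊥-elim (n≮0 s<t)
        ... | inj₂ (inj₁ (s' , refl , s'≤m)) | inj₂ (inj₁ (t' , refl , t'≤m)) =
          distinct s' t' (≤-pred s<t) t'≤m (trans (sym (path-mid s' s'≤m)) (trans e (path-mid t' t'≤m)))
        ... | inj₂ (inj₁ (s' , refl , s'≤m)) | inj₂ (inj₂ refl) = s₂∉C (subst Comp (trans (sym (path-mid s' s'≤m)) (trans e path-top)) (on-walk s' s'≤m))
        ... | inj₂ (inj₂ refl) | inj₁ refl = ⊥-elim (n≮0 s<t)
        ... | inj₂ (inj₂ refl) | inj₂ (inj₁ (t' , refl , t'≤m)) = ⊥-elim (<⇒≱ s<t (s≤s (≤-trans t'≤m (n≤1+n m))))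
        ... | inj₂ (inj₂ refl) | inj₂ (inj₂ refl) = <-irrefl refl s<t
        path-≢a : ∀ t → t ≤ M → path t ≢ a
        path-≢a t t≤M e with position t t≤M
        ... | inj₁ refl = boundary-≢a ∂s₁ e
        ... | inj₂ (inj₁ (t' , refl , t'≤m)) = proj₁ (proj₂ (comp-within (on-walk t' t'≤m))) (trans (sym (path-mid t' t'≤m)) e)
        ... | inj₂ (inj₂ refl) = boundary-≢a ∂s₂ (trans (sym path-top) e)
        path-chordless : ∀ s t → suc s < t → t ≤ M → ¬ Adj G (path s) (path t)
        path-chordless s t 1+s<t t≤M adj with position s (<⇒≤ (<-trans (n<1+n s) (<-≤-trans 1+s<t t≤M))) | position t t≤M
        ... | inj₁ refl | inj₁ refl = ⊥-elim (n≮0 1+s<t)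
        ... | inj₁ refl | inj₂ (inj₁ (t' , refl , t'≤m)) = A-only-at-start t' (≤-pred 1+s<t) t'≤m (subst (Adj G s₁) (path-mid t' t'≤m) adj)
        ... | inj₁ refl | inj₂ (inj₂ refl) = s₁≁s₂ (subst (Adj G s₁) path-top adj)
        ... | inj₂ (inj₁ (s' , refl , s'≤m)) | inj₁ refl = ⊥-elim (n≮0 1+s<t)
        ... | inj₂ (inj₁ (s' , refl , s'≤m)) | inj₂ (inj₁ (t' , refl , t'≤m)) =
          chordless s' t' (≤-pred 1+s<t) t'≤m (subst₂ (Adj G) (path-mid s' s'≤m) (path-mid t' t'≤m) adj)
        ... | inj₂ (inj₁ (s' , refl , s'≤m)) | inj₂ (inj₂ refl) =
          B-only-at-end s' (≤-pred (≤-pred 1+s<t)) (symA _ _ (subst₂ (Adj G) (path-mid s' s'≤m) path-top adj))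
        ... | inj₂ (inj₂ refl) | _ = ⊥-elim (<⇒≱ 1+s<t (≤-trans t≤M (n≤1+n M)))
        interior-≁ : ∀ t → 0 < t → t < M → ¬ Adj G a (path t)
        interior-≁ (suc t) _ (s≤s t<1+m) adj =
          proj₂ (proj₂ (comp-within (on-walk t (≤-pred t<1+m)))) (subst (Adj G a) (path-mid t (≤-pred t<1+m)) adj)

  -- Dirac's lemma, relativised to U, by induction on ∣U∣: recurse into the component of b plus its boundary.
  ¬¬-simplicial-non-neighbour : ∀ U a → T (U a) → ∀ b → T (U b) → b ≢ a → ¬ Adj G a b → DoubleNegation (SimplicialNonNeighbour U a)
  ¬¬-simplicial-non-neighbour U = go (count U) U ≤-refl
    where
    go : ∀ N U → count U ≤ N → ∀ a → T (U a) → ∀ b → T (U b) → b ≢ a → ¬ Adj G a b → DoubleNegation (SimplicialNonNeighbour U a)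
    go N U ∣U∣≤N a Ua b Ub b≢a a≁b = ¬¬-characteristic Closure >>= recurse
      where
      open Step U a b Ub b≢a a≁b
      recurse : Characteristic Closure → DoubleNegation (SimplicialNonNeighbour U a)
      recurse χ-closure = do
        no non-clique ← ¬¬-excluded-middle {A = ∀ v w → T (U′ v) → T (U′ w) → v ≢ w → Adj G v w}
          where yes clique → pure (lift-simplicial U′ complete b comp-root (λ v w U′v U′w _ _ v≢w → clique v w U′v U′w v≢w))
        no ∄boundary-non-edge ← ¬¬-excluded-middle
          where yes (s , ∂s , w , U′w , w≢s , s≁w) → do
                  (y , U′y , y≢s , s≁y , simplicial) ← IH s (complete s (inj₂ ∂s)) w U′w w≢s s≁w
                  pure (lift-simplicial U′ complete y (in-comp y U′y λ ∂y → s≁y (boundary-clique s y ∂s ∂y (y≢s ∘ sym))) simplicial)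
        (v , w , U′v , U′w , v≢w , v≁w) ← ¬¬-non-edge non-clique
        (y , U′y , y≢v , v≁y , simplicial) ← IH v U′v w U′w (v≢w ∘ sym) v≁w
        pure (lift-simplicial U′ complete y
               (in-comp y U′y λ ∂y → ∄boundary-non-edge (y , ∂y , v , U′v , y≢v ∘ sym , v≁y ∘ symA _ _)) simplicial)
        where
        open Characteristic χ-closure renaming (χ to U′)
        U′⊆U : ∀ v → T (U′ v) → T (U v)
        U′⊆U v U′v with sound v U′v
        ... | inj₁ Cv = proj₁ (comp-within Cv)
        ... | inj₂ ∂v = proj₁ ∂v
        a∉U′ : ¬ T (U′ a)
        a∉U′ U′a with sound a U′a
        ... | inj₁ Ca = proj₁ (proj₂ (comp-within Ca)) refl
        ... | inj₂ ∂a = boundary-≢a ∂a refl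
        ∣U′∣<∣U∣ : count U′ < count U
        ∣U′∣<∣U∣ = subst (count U′ <_) (sym (count-remove U a Ua))
                     (s≤s (count-mono λ i U′i → T-∧-intro (U′⊆U i U′i) (T-not-intro λ i≟a → a∉U′ (subst (T ∘ U′) (T-≟⇒≡ i≟a) U′i))))
        IH : ∀ a′ → T (U′ a′) → ∀ b′ → T (U′ b′) → b′ ≢ a′ → ¬ Adj G a′ b′ → DoubleNegation (SimplicialNonNeighbour U′ a′)
        IH = descend N ∣U∣≤N
          where
          descend : ∀ M → count U ≤ M → ∀ a′ → T (U′ a′) → ∀ b′ → T (U′ b′) → b′ ≢ a′ → ¬ Adj G a′ b′ → DoubleNegation (SimplicialNonNeighbour U′ a′)
          descend (suc M) ∣U∣≤1+M = go M U′ (≤-pred (<-≤-trans ∣U′∣<∣U∣ ∣U∣≤1+M))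
          descend zero ∣U∣≤0 = ⊥-elim (n≮0 (<-≤-trans ∣U′∣<∣U∣ ∣U∣≤0))
        in-comp : ∀ y → T (U′ y) → ¬ Boundary y → Comp y
        in-comp y U′y ¬∂y with sound y U′y
        ... | inj₁ Cy = Cy
        ... | inj₂ ∂y = ⊥-elim (¬∂y ∂y)
        ¬¬-non-edge : ¬ (∀ v w → T (U′ v) → T (U′ w) → v ≢ w → Adj G v w) →
                      DoubleNegation (Σ (Fin n) λ v → Σ (Fin n) λ w → T (U′ v) × T (U′ w) × v ≢ w × ¬ Adj G v w)
        ¬¬-non-edge non-clique = do
          no ∄non-edge ← ¬¬-excluded-middle
            where yes non-edge → pure non-edge
          ⊥-elim (non-clique λ v w U′v U′w v≢w → Adj-stable {G = G} λ v≁w → ∄non-edge (v , w , U′v , U′w , v≢w , v≁w))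

module MinimumDegree {n : ℕ} (G : Graph n) (symA : ∀ u v → Adj G u v → Adj G v u) (irr : ∀ u → ¬ Adj G u u)
    (chG : Chordal G) (no-universal : ¬ (∃ λ x → Universal G x)) where
  open Simplicial G symA chG

  IsSimplicial : Fin n → Set
  IsSimplicial = SimplicialIn (λ _ → true)

  ¬¬-non-neighbour : ∀ a → DoubleNegation (Σ (Fin n) λ b → b ≢ a × ¬ Adj G a b)
  ¬¬-non-neighbour a = do
    no ∄b ← ¬¬-excluded-middle
      where yes b → pure b
    ⊥-elim (no-universal (a , λ y y≢a → Adj-stable {G = G} λ a≁y → ∄b (y , y≢a , a≁y)))

  ¬¬-simplicial-non-neighbour′ : ∀ a → DoubleNegation (Σ (Fin n) λ y → y ≢ a × ¬ Adj G a y × IsSimplicial y)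
  ¬¬-simplicial-non-neighbour′ a = do
    (b , b≢a , a≁b) ← ¬¬-non-neighbour a
    (y , _ , y≢a , a≁y , simplicial) ← ¬¬-simplicial-non-neighbour (λ _ → true) a tt b tt b≢a a≁b
    pure (y , y≢a , a≁y , simplicial)

  degree : Fin n → ℕ
  degree x = count (adj G x)

  SmallSeparator : Set
  SmallSeparator = Σ (Subset n) λ W → Separating G W × Σ ℕ λ r → ∣ W ∣ + 1 + r ≡ n × 4 * ∣ W ∣ ≤ r * r

  module _ (x : Fin n) (x-simplicial : IsSimplicial x) (x-minimum : ∀ y → IsSimplicial y → degree x ≤ degree y) where

    Witness : Fin n → Set
    Witness y = IsSimplicial y × ¬ Adj G x y × y ≢ x

    Covers : (Fin n → Bool) → Set
    Covers Y = (∀ y → T (Y y) → Witness y) × (∀ v → Adj G x v → Σ (Fin n) λ y → T (Y y) × ¬ Adj G v y × y ≢ v)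

    ¬¬-cover : DoubleNegation (Σ (Fin n → Bool) Covers)
    ¬¬-cover = do
      χ-witness ← ¬¬-characteristic Witness
      missed ← ¬¬-choice {P = λ v → Adj G x v → Σ (Fin n) λ y → y ≢ v × ¬ Adj G v y × IsSimplicial y}
                         (λ v → ¬¬-simplicial-non-neighbour′ v >>= λ y → pure λ _ → y)
      let open Characteristic χ-witness
      pure (χ , sound , λ v x~v → let (y , y≢v , v≁y , y-simplicial) = missed v x~v in
                                  y , complete y (witness v y x~v y≢v v≁y y-simplicial) , v≁y , y≢v)
      where
      witness : ∀ v y → Adj G x v → y ≢ v → ¬ Adj G v y → IsSimplicial y → Witness y
      witness v y x~v y≢v v≁y y-simplicial =
        y-simplicial , (λ x~y → v≁y (x-simplicial v y tt tt x~v x~y (y≢v ∘ sym))) , λ { refl → v≁y (symA _ _ x~v) }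

    module _ (Y : Fin n → Bool) (Y-covers : Covers Y) (Y-minimum : ∀ Y′ → Covers Y′ → count Y ≤ count Y′) where

      -- If y₁ ~ y₂, every neighbour of x missing y₂ also misses the simplicial y₁, so y₂ could be dropped.
      Y-independent : ∀ y₁ y₂ → T (Y y₁) → T (Y y₂) → y₁ ≢ y₂ → ¬ Adj G y₁ y₂
      Y-independent y₁ y₂ Yy₁ Yy₂ y₁≢y₂ y₁~y₂ = <-irrefl refl (subst (_≤ count Y′) (count-remove Y y₂ Yy₂) (Y-minimum Y′ Y′-covers))
        where
        Y′ : Fin n → Bool
        Y′ i = Y i ∧ not ⌊ i ≟ y₂ ⌋
        Y′-covers : Covers Y′
        Y′-covers = (λ y Y′y → proj₁ Y-covers y (T-∧-fst Y′y)) , missed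
          where
          missed : ∀ v → Adj G x v → Σ (Fin n) λ y → T (Y′ y) × ¬ Adj G v y × y ≢ v
          missed v x~v with proj₂ Y-covers v x~v
          ... | y , Yy , v≁y , y≢v with y ≟ y₂
          ...   | no y≢y₂ = y , T-∧-intro Yy (T-not-intro (y≢y₂ ∘ T-≟⇒≡)) , v≁y , y≢v
          ...   | yes refl = y₁ , T-∧-intro Yy₁ (T-not-intro (y₁≢y₂ ∘ T-≟⇒≡)) ,
                    (λ v~y₁ → v≁y (proj₁ (proj₁ Y-covers y₁ Yy₁) v y tt tt (symA _ _ v~y₁) y₁~y₂ (y≢v ∘ sym))) ,
                    (λ { refl → v≁y y₁~y₂ })

      N⟨x⟩ R : Fin n → Bool
      N⟨x⟩ v = adj G x v
      R v = not (adj G x v) ∧ not ⌊ v ≟ x ⌋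
      Lost Gained : Fin n → Fin n → Bool
      Lost y v = adj G x v ∧ not (adj G y v)
      Gained y v = adj G y v ∧ not (adj G x v)

      d = count N⟨x⟩
      r = count R
      b = count Y

      Y⊆R : ∀ v → T (Y v) → T (R v)
      Y⊆R v Yv = T-∧-intro (T-not-intro (proj₁ (proj₂ (proj₁ Y-covers v Yv)))) (T-not-intro (proj₂ (proj₂ (proj₁ Y-covers v Yv)) ∘ T-≟⇒≡))

      lost≤gained : ∀ y → T (Y y) → count (Lost y) ≤ count (Gained y)
      lost≤gained y Yy = +-cancelˡ-≤ common _ _ (subst₂ _≤_ (count-split N⟨x⟩ (adj G y))
                           (trans (count-split (adj G y) (adj G x)) (cong (_+ count (Gained y)) (sym common-comm)))
                           (x-minimum y (proj₁ (proj₁ Y-covers y Yy))))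
        where
        common = count (λ v → adj G x v ∧ adj G y v)
        common-comm : common ≡ count (λ v → adj G y v ∧ adj G x v)
        common-comm = sum-cong-≗ (λ v → cong 𝟙 (∧-comm (adj G x v) (adj G y v)))

      gained+b≤r : ∀ y → T (Y y) → count (Gained y) + b ≤ r
      gained+b≤r y Yy = count-disjoint-≤ disjoint gained⊆R Y⊆R
        where
        disjoint : ∀ v → T (Gained y v) → T (Y v) → ⊥
        disjoint v gained Yv = Y-independent y v Yy Yv (λ { refl → irr y (T-∧-fst gained) }) (T-∧-fst gained)
        gained⊆R : ∀ v → T (Gained y v) → T (R v)
        gained⊆R v gained = T-∧-intro (T-∧-snd gained)
          (T-not-intro λ v≟x → proj₁ (proj₂ (proj₁ Y-covers y Yy)) (symA _ _ (subst (Adj G y) (T-≟⇒≡ v≟x) (T-∧-fst gained))))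

      d≤∑lost : d ≤ sum (λ y → 𝟙 (Y y) * count (Lost y))
      d≤∑lost = ≤-trans (sum-mono-≤ counted) (≤-reflexive (trans (∑-comm (λ v y → 𝟙 (Y y) * 𝟙 (Lost y v)))
                          (sum-cong-≗ λ y → sym (*-distribˡ-sum (𝟙 (Y y)) (λ v → 𝟙 (Lost y v))))))
        where
        counted : ∀ v → 𝟙 (N⟨x⟩ v) ≤ sum (λ y → 𝟙 (Y y) * 𝟙 (Lost y v))
        counted v with T? (N⟨x⟩ v)
        ... | no v∉N[x] rewrite ¬T⇒≡false v∉N[x] = z≤n
        ... | yes x~v with proj₂ Y-covers v x~v
        ...   | y , Yy , v≁y , _ = subst (_≤ sum (λ y → 𝟙 (Y y) * 𝟙 (Lost y v))) one (term≤sum (λ y → 𝟙 (Y y) * 𝟙 (Lost y v)) y)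
          where
          one : 𝟙 (Y y) * 𝟙 (Lost y v) ≡ 𝟙 (N⟨x⟩ v)
          one rewrite T⇒≡true Yy | T⇒≡true x~v | ¬T⇒≡false (v≁y ∘ symA _ _) = refl

      ∑lost≤kb : sum (λ y → 𝟙 (Y y) * count (Lost y)) ≤ (r ∸ b) * b
      ∑lost≤kb = ≤-trans (sum-mono-≤ bounded) (≤-reflexive (trans (sum-cong-≗ λ y → *-comm (𝟙 (Y y)) (r ∸ b))
                                                                  (sym (*-distribˡ-sum (r ∸ b) (λ y → 𝟙 (Y y))))))
        where
        bounded : ∀ y → 𝟙 (Y y) * count (Lost y) ≤ 𝟙 (Y y) * (r ∸ b)
        bounded y with T? (Y y)
        ... | no y∉Y rewrite ¬T⇒≡false y∉Y = z≤n
        ... | yes Yy rewrite T⇒≡true Yy = +-monoˡ-≤ 0 (≤-trans (lost≤gained y Yy) (m+n≤o⇒m≤o∸n (count (Gained y)) (gained+b≤r y Yy)))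

      4d≤r² : 4 * d ≤ r * r
      4d≤r² = ≤-trans (*-monoʳ-≤ 4 (≤-trans d≤∑lost (≤-trans ∑lost≤kb (≤-reflexive (*-comm (r ∸ b) b)))))
                      (subst (λ z → 4 * (b * (r ∸ b)) ≤ z * z) (m+[n∸m]≡n (count-mono Y⊆R)) (4xy≤[x+y]² b (r ∸ b)))

      d+1+r≡n : d + 1 + r ≡ n
      d+1+r≡n = begin
        d + 1 + r                                                    ≡⟨ cong (λ z → d + z + r) (sym (count-singleton x)) ⟩
        d + count (λ v → ⌊ v ≟ x ⌋) + r                              ≡⟨ cong (_+ r) (∑-distrib-+ (𝟙 ∘ N⟨x⟩) (λ v → 𝟙 ⌊ v ≟ x ⌋)) ⟨
        sum (λ v → 𝟙 (N⟨x⟩ v) + 𝟙 ⌊ v ≟ x ⌋) + r                    ≡⟨ ∑-distrib-+ (λ v → 𝟙 (N⟨x⟩ v) + 𝟙 ⌊ v ≟ x ⌋) (𝟙 ∘ R) ⟨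
        sum (λ v → 𝟙 (N⟨x⟩ v) + 𝟙 ⌊ v ≟ x ⌋ + 𝟙 (R v))              ≡⟨ sum-cong-≗ partition ⟩
        count {n} (λ _ → true)                                       ≡⟨ count-true n ⟩
        n                                                            ∎
        where
        open ≡-Reasoning
        partition : ∀ v → 𝟙 (N⟨x⟩ v) + 𝟙 ⌊ v ≟ x ⌋ + 𝟙 (R v) ≡ 1
        partition v with v ≟ x
        ... | yes refl rewrite ¬T⇒≡false (irr x) = refl
        partition v | no _ with adj G x v
        ...   | true = refl
        ...   | false = refl

      ¬¬-small-separator : DoubleNegation SmallSeparator
      ¬¬-small-separator = do
        (y , y≢x , x≁y) ← ¬¬-non-neighbour x
        pure (tabulate N⟨x⟩ , (x , y , irr x ∘ ∈-tabulate⁻ , x≁y ∘ ∈-tabulate⁻ , unreachable y≢x) ,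
              r , subst (λ z → z + 1 + r ≡ n) (sym (∣tabulate∣≡count N⟨x⟩)) d+1+r≡n ,
                  subst (λ z → 4 * z ≤ r * r) (sym (∣tabulate∣≡count N⟨x⟩)) 4d≤r²)
        where
        unreachable : ∀ {y} → y ≢ x → ¬ Reach G (tabulate N⟨x⟩) x y
        unreachable y≢x (here _) = y≢x refl
        unreachable y≢x (step _ x~w w⇝y) = reach-source-∉ w⇝y (∈-tabulate⁺ x~w)

  ¬¬-simplicial-separator : Fin n → DoubleNegation SmallSeparator
  ¬¬-simplicial-separator v₀ = do
    (y₀ , _ , _ , y₀-simplicial) ← ¬¬-simplicial-non-neighbour′ v₀
    (x , x-simplicial , x-minimum) ← ¬¬-minimum IsSimplicial degree (y₀ , y₀-simplicial)
    (Y , Y-covers) ← ¬¬-cover x x-simplicial x-minimum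
    (Y , Y-covers , Y-minimum) ← ¬¬-minimum (Covers x x-simplicial x-minimum) count (Y , Y-covers)
    ¬¬-small-separator x x-simplicial x-minimum Y Y-covers Y-minimum

separator-bound : ∀ {n c w r} → IsCeilTwoSqrt n c → w + 1 + r ≡ n → 4 * w ≤ r * r → w ≤ (n ∸ 1) ∸ (c ∸ 2)
separator-bound {n} {c} {w} {r} (_ , c-least) w+1+r≡n 4w≤r² = begin
  w                  ≡⟨ m+n∸n≡m w r ⟨
  w + r ∸ r          ≤⟨ ∸-monoʳ-≤ (w + r) c∸2≤r ⟩
  w + r ∸ (c ∸ 2)    ≡⟨ cong (_∸ (c ∸ 2)) w+r≡n∸1 ⟩
  n ∸ 1 ∸ (c ∸ 2)    ∎
  where
  open ≤-Reasoning
  expand-4n : ∀ w r → 4 * (w + 1 + r) ≡ 4 * w + (4 * r + 4)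
  expand-4n = solve-∀
  expand-square : ∀ r → (r + 2) * (r + 2) ≡ r * r + (4 * r + 4)
  expand-square = solve-∀
  c≤r+2 : c ≤ r + 2
  c≤r+2 = c-least (r + 2) (subst₂ _≤_ (trans (sym (expand-4n w r)) (cong (4 *_) w+1+r≡n)) (sym (expand-square r)) (+-monoˡ-≤ (4 * r + 4) 4w≤r²))
  c∸2≤r : c ∸ 2 ≤ r
  c∸2≤r = subst (c ∸ 2 ≤_) (m+n∸n≡m r 2) (∸-monoˡ-≤ 2 c≤r+2)
  w+r≡n∸1 : w + r ≡ n ∸ 1
  w+r≡n∸1 = cong (_∸ 1) (trans (sym (+-suc w r)) (trans (sym (+-assoc w 1 r)) w+1+r≡n))

κ≤n-1-[c-2] : ∀ {n c k} (G : Graph n) → Fin n → IsSimple G → Chordal* G → IsCeilTwoSqrt n c →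
              IsConnectivity G k → k ≤ (n ∸ 1) ∸ (c ∸ 2)
κ≤n-1-[c-2] G v₀ (symA , irr) (chG , no-universal) c-ceil (_ , κ-minimal) = ≤-stable do
  (W , W-separating , r , ∣W∣+1+r≡n , 4∣W∣≤r²) ← MinimumDegree.¬¬-simplicial-separator G symA irr chG no-universal v₀
  pure (≤-trans (κ-minimal W W-separating) (separator-bound c-ceil ∣W∣+1+r≡n 4∣W∣≤r²))

-- Split graphs realising every connectivity

split⇒chordal : ∀ {n} (G : Graph n) (inS : Fin n → Bool)
  → (∀ u v → T (inS u) → T (inS v) → u ≢ v → Adj G u v)
  → (∀ u v → ¬ T (inS u) → ¬ T (inS v) → ¬ Adj G u v)
  → Chordal G
split⇒chordal {n} G inS S-clique outside-independent C = chord
  where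
  L = len C
  L≥4 = len≥4 C
  v = vert C
  index : ∀ t → t < L → Fin L
  index t p = fromℕ< p
  toℕ-index : ∀ t (p : t < L) → toℕ (index t p) ≡ t
  toℕ-index t p = toℕ-fromℕ< p
  p0 : 0 < L
  p0 = ≤-trans (s≤s z≤n) L≥4
  p1 : 1 < L
  p1 = ≤-trans (s≤s (s≤s z≤n)) L≥4
  p2 : 2 < L
  p2 = ≤-trans (s≤s (s≤s (s≤s z≤n))) L≥4
  p3 : 3 < L
  p3 = L≥4
  i0 = index 0 p0
  i3 = index 3 p3
  consecutive-adjacent : ∀ a b (pa : a < L) (pb : b < L) → suc a ≡ b → Adj G (v (index a pa)) (v (index b pb))
  consecutive-adjacent a b pa pb e = edges C _ _ (inj₁ (trans (cong suc (toℕ-index a pa)) (trans e (sym (toℕ-index b pb)))))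
  distinct-vertices : ∀ a b (pa : a < L) (pb : b < L) → a ≢ b → v (index a pa) ≢ v (index b pb)
  distinct-vertices a b pa pb ne e = ne (trans (sym (toℕ-index a pa)) (trans (cong toℕ (inj C _ _ e)) (toℕ-index b pb)))
  chord-at : ∀ a b (pa : a < L) (pb : b < L) → a ≢ b → suc a ≢ b → suc b ≢ a → ¬ (a ≡ 0 × suc b ≡ L) → ¬ (b ≡ 0 × suc a ≡ L)
          → Adj G (v (index a pa)) (v (index b pb)) → HasChord C
  chord-at a b pa pb n0 n1 n2 n3 n4 ad = index a pa , index b pb ,
      (λ e → n0 (trans (sym (toℕ-index a pa)) (trans (cong toℕ e) (toℕ-index b pb)))) , ncyc , ad
    where
    ta = toℕ-index a pa
    tb = toℕ-index b pb
    ncyc : ¬ CycNb L (index a pa) (index b pb)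
    ncyc (inj₁ e) = n1 (trans (cong suc (sym ta)) (trans e tb))
    ncyc (inj₂ (inj₁ e)) = n2 (trans (cong suc (sym tb)) (trans e ta))
    ncyc (inj₂ (inj₂ (inj₁ (e0 , e)))) = n3 (trans (sym ta) e0 , trans (cong suc (sym tb)) e)
    ncyc (inj₂ (inj₂ (inj₂ (e0 , e)))) = n4 (trans (sym tb) e0 , trans (cong suc (sym ta)) e)
  in-S? : ∀ a (pa : a < L) → Dec (T (inS (v (index a pa))))
  in-S? a pa = T? (inS (v (index a pa)))
  L≢3 : L ≢ 3
  L≢3 e = <-irrefl (sym e) (subst (3 <_) refl L≥4)
  -- Outside vertices are never consecutive, so two vertices at distance 2 among the first five lie in S.
  chord : HasChord C
  chord with in-S? 0 p0 | in-S? 2 p2 | in-S? 1 p1 | in-S? 3 p3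
  ... | yes s0 | yes s2 | _ | _ = chord-at 0 2 p0 p2 (λ ()) (λ ()) (λ ()) (λ { (_ , e) → L≢3 (sym e) }) (λ { (() , _) })
      (S-clique _ _ s0 s2 (distinct-vertices 0 2 p0 p2 (λ ())))
  ... | _ | _ | yes s1 | yes s3 = chord-at 1 3 p1 p3 (λ ()) (λ ()) (λ ()) (λ { (() , _) }) (λ { (() , _) })
      (S-clique _ _ s1 s3 (distinct-vertices 1 3 p1 p3 (λ ())))
  ... | no n0 | _ | no n1 | _ = ⊥-elim (outside-independent _ _ n0 n1 (consecutive-adjacent 0 1 p0 p1 refl))
  ... | _ | no n2 | no n1 | _ = ⊥-elim (outside-independent _ _ n1 n2 (consecutive-adjacent 1 2 p1 p2 refl))
  ... | _ | no n2 | _ | no n3 = ⊥-elim (outside-independent _ _ n2 n3 (consecutive-adjacent 2 3 p2 p3 refl))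
  ... | no n0 | yes s2 | yes s1 | no n3 = chord-beyond-4
    where
    chord-beyond-4 : HasChord C
    chord-beyond-4 with m≤n⇒m<n∨m≡n L≥4
    ... | inj₂ e = ⊥-elim (outside-independent _ _ n3 n0 (edges C i3 i0 (inj₂ (inj₂ (inj₂ (toℕ-index 0 p0 , trans (cong suc (toℕ-index 3 p3)) e))))))
    ... | inj₁ p4 with in-S? 4 p4
    ...   | no n4 = ⊥-elim (outside-independent _ _ n3 n4 (consecutive-adjacent 3 4 p3 p4 refl))
    ...   | yes s4 = chord-at 1 4 p1 p4 (λ ()) (λ ()) (λ ()) (λ { (() , _) }) (λ { (() , _) }) (S-clique _ _ s1 s4 (distinct-vertices 1 4 p1 p4 (λ ())))

module Construction (n s m k : ℕ) (s+m≡n : s + m ≡ n) (k≤s : k ≤ s) (2≤m : 2 ≤ m) (k≤[m∸1]d : k ≤ (m ∸ 1) * (s ∸ k)) where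
  d = s ∸ k
  k+d≡s : k + d ≡ s
  k+d≡s = m+[n∸m]≡n k≤s

  -- Vertices 0, …, s − 1 form a clique and s, …, s + m − 1 an independent set. The independent vertex s + i
  -- misses exactly the window of d = s − k clique vertices j with k ≤ j + i d < k + d, so it has degree k;
  -- the windows for i < m cover the clique because k ≤ (m − 1) d, so no vertex is universal.
  misses : ℕ → ℕ → Bool
  misses i j = (k ≤ᵇ j + i * d) ∧ (j + i * d <ᵇ k + d)

  adjacentℕ : ℕ → ℕ → Bool
  adjacentℕ a b = if a <ᵇ s then (if b <ᵇ s then true else not (misses (b ∸ s) a)) else (if b <ᵇ s then not (misses (a ∸ s) b) else false)

  adjacentℕ-sym : ∀ a b → adjacentℕ a b ≡ adjacentℕ b a
  adjacentℕ-sym a b with a <ᵇ s | b <ᵇ s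
  ... | true | true = refl
  ... | true | false = refl
  ... | false | true = refl
  ... | false | false = refl

  adjacent : Fin n → Fin n → Bool
  adjacent u v = not ⌊ u ≟ v ⌋ ∧ adjacentℕ (toℕ u) (toℕ v)

  G : Graph n
  G = graph adjacent

  adjacent-sym : ∀ u v → adjacent u v ≡ adjacent v u
  adjacent-sym u v = cong₂ (λ x y → not x ∧ y) (≟-sym u v) (adjacentℕ-sym (toℕ u) (toℕ v))

  simple : IsSimple G
  simple = (λ u v t → subst T (adjacent-sym u v) t) , irr
    where
    irr : ∀ u → ¬ Adj G u u
    irr u t with u ≟ u
    ... | yes _ = t
    ... | no ne = ne refl

  clique-adjacent : ∀ u v → toℕ u < s → toℕ v < s → u ≢ v → Adj G u v
  clique-adjacent u v us vs ne rewrite ≢⇒≟-false ne | T⇒≡true (<⇒<ᵇ us) | T⇒≡true (<⇒<ᵇ vs) = tt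

  independent-nonadjacent : ∀ u v → s ≤ toℕ u → s ≤ toℕ v → ¬ Adj G u v
  independent-nonadjacent u v us vs t with u ≟ v
  ... | yes _ = t
  ... | no _ rewrite ¬T⇒≡false (λ x → <⇒≱ (T<ᵇ⇒< x) us) | ¬T⇒≡false (λ x → <⇒≱ (T<ᵇ⇒< x) vs) = t

  adjacent⇒¬misses : ∀ u v → toℕ u < s → s ≤ toℕ v → Adj G u v → ¬ T (misses (toℕ v ∸ s) (toℕ u))
  adjacent⇒¬misses u v us vs t tm with u ≟ v
  ... | yes _ = t
  ... | no _ rewrite T⇒≡true (<⇒<ᵇ us) | ¬T⇒≡false (λ x → <⇒≱ (T<ᵇ⇒< x) vs) | T⇒≡true tm = t

  ¬misses⇒adjacent : ∀ u v → toℕ u < s → s ≤ toℕ v → ¬ T (misses (toℕ v ∸ s) (toℕ u)) → Adj G u v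
  ¬misses⇒adjacent u v us vs nm rewrite ≢⇒≟-false {u = u} {v} (λ e → <⇒≱ us (subst (λ z → s ≤ toℕ z) (sym e) vs))
    | T⇒≡true (<⇒<ᵇ us) | ¬T⇒≡false (λ x → <⇒≱ (T<ᵇ⇒< x) vs) | ¬T⇒≡false nm = tt

  clique<n : ∀ {j} → j < s → j < n
  clique<n {j} p = subst (j <_) s+m≡n (≤-trans p (m≤m+n s m))
  clique-vertex : ∀ j → j < s → Fin n
  clique-vertex j p = fromℕ< (clique<n p)
  toℕ-clique-vertex : ∀ j p → toℕ (clique-vertex j p) ≡ j
  toℕ-clique-vertex j p = toℕ-fromℕ< (clique<n p)
  independent<n : ∀ {i} → i < m → s + i < n
  independent<n {i} p = subst (s + i <_) s+m≡n (+-monoʳ-< s p)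
  independent-vertex : ∀ i → i < m → Fin n
  independent-vertex i p = fromℕ< (independent<n p)
  toℕ-independent-vertex : ∀ i p → toℕ (independent-vertex i p) ≡ s + i
  toℕ-independent-vertex i p = toℕ-fromℕ< (independent<n p)

  0<m : 0 < m
  0<m = ≤-trans (s≤s z≤n) 2≤m
  1<m : 1 < m
  1<m = 2≤m

  chordal : Chordal G
  chordal = split⇒chordal G (λ v → toℕ v <ᵇ s) (λ u v tu tv ne → clique-adjacent u v (T<ᵇ⇒< tu) (T<ᵇ⇒< tv) ne)
                          (λ u v nu nv → independent-nonadjacent u v (≮⇒≥ (λ x → nu (<⇒<ᵇ x))) (≮⇒≥ (λ x → nv (<⇒<ᵇ x))))

  some-independent-misses : ∀ j → j < k + d → ∀ i → k ≤ j + i * d → Σ ℕ λ i' → i' ≤ i × T (misses i' j)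
  some-independent-misses j j< zero le = 0 , z≤n , T-∧-intro (≤⇒≤ᵇ le) (<⇒<ᵇ (subst (_< k + d) (sym (+-identityʳ j)) j<))
  some-independent-misses j j< (suc i) le with k ≤? j + i * d
  ... | yes le' = let (i' , i'≤ , t) = some-independent-misses j j< i le' in i' , ≤-trans i'≤ (n≤1+n i) , t
  ... | no nle = suc i , ≤-refl , T-∧-intro (≤⇒≤ᵇ le) (<⇒<ᵇ lt)
    where
    lt : j + (d + i * d) < k + d
    lt = subst (λ z → suc z ≤ k + d) (sym (trans (cong (j +_) (+-comm d (i * d))) (sym (+-assoc j (i * d) d))))
           (+-monoˡ-≤ d (≰⇒> nle))

  no-universal : ¬ (∃ λ x → Universal G x)
  no-universal (x , ux) with toℕ x <? s
  ... | yes xs = adjacent⇒¬misses x y xs sy (ux y y≢x) (subst (λ z → T (misses z (toℕ x))) (sym ty) t)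
    where
    j = toℕ x
    missing = some-independent-misses j (subst (j <_) (sym k+d≡s) xs) (m ∸ 1) (≤-trans k≤[m∸1]d (m≤n+m _ j))
    i = proj₁ missing
    t = proj₂ (proj₂ missing)
    i<m : i < m
    i<m = subst (suc i ≤_) (m+[n∸m]≡n 0<m) (s≤s (proj₁ (proj₂ missing)))
    y = independent-vertex i i<m
    sy : s ≤ toℕ y
    sy = subst (s ≤_) (sym (toℕ-independent-vertex i i<m)) (m≤m+n s i)
    y≢x : y ≢ x
    y≢x e = <⇒≱ xs (subst (s ≤_) (cong toℕ e) sy)
    ty : toℕ y ∸ s ≡ i
    ty = trans (cong (_∸ s) (toℕ-independent-vertex i i<m)) (m+n∸m≡n s i)
  ... | no xs with x ≟ independent-vertex 0 0<m
  ...   | yes e = independent-nonadjacent x (independent-vertex 1 1<m) (≮⇒≥ xs) (subst (s ≤_) (sym (toℕ-independent-vertex 1 1<m)) (m≤m+n s 1)) (ux _ ne)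
    where
    ne : independent-vertex 1 1<m ≢ x
    ne e' = 1+n≢n (+-cancelˡ-≡ s (suc 0) 0 (trans (sym (toℕ-independent-vertex 1 1<m)) (trans (cong toℕ (trans e' e)) (toℕ-independent-vertex 0 0<m))))
  ...   | no ne = independent-nonadjacent x (independent-vertex 0 0<m) (≮⇒≥ xs)
      (subst (s ≤_) (sym (toℕ-independent-vertex 0 0<m)) (m≤m+n s 0)) (ux _ (λ e → ne (sym e)))

  symmetric : ∀ u v → Adj G u v → Adj G v u
  symmetric = proj₁ simple

  N⟨x₀⟩ : Subset n
  N⟨x₀⟩ = tabulate (λ v → toℕ v <ᵇ k)

  k≤n : k ≤ n
  k≤n = subst (k ≤_) s+m≡n (≤-trans k≤s (m≤m+n s m))

  ∣N⟨x₀⟩∣≡k : ∣ N⟨x₀⟩ ∣ ≡ k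
  ∣N⟨x₀⟩∣≡k = trans (∣tabulate∣≡count {n} (λ v → toℕ v <ᵇ k)) (count-below n k k≤n)

  independent∉N⟨x₀⟩ : ∀ i (p : i < m) → independent-vertex i p ∉ N⟨x₀⟩
  independent∉N⟨x₀⟩ i p t = <⇒≱ (T<ᵇ⇒< (∈-tabulate⁻ t)) (subst (k ≤_) (sym (toℕ-independent-vertex i p)) (≤-trans k≤s (m≤m+n s i)))

  N⟨x₀⟩-separating : Separating G N⟨x₀⟩
  N⟨x₀⟩-separating = independent-vertex 0 0<m , independent-vertex 1 1<m , independent∉N⟨x₀⟩ 0 0<m , independent∉N⟨x₀⟩ 1 1<m , unreachable (trans (toℕ-independent-vertex 0 0<m) (+-identityʳ s)) (trans (toℕ-independent-vertex 1 1<m) (trans (+-suc s 0) (cong suc (+-identityʳ s))))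
    where
    unreachable : ∀ {a b} → toℕ a ≡ s → toℕ b ≡ suc s → ¬ Reach G N⟨x₀⟩ a b
    unreachable ea eb (here _) = 1+n≢n (trans (sym eb) ea)
    unreachable {a} ea eb (step {w = w} _ ad r) with toℕ w <? s
    ... | no s≤w = independent-nonadjacent _ _ (≤-reflexive (sym ea)) (≮⇒≥ s≤w) ad
    ... | yes s≤w = reach-source-∉ r (∈-tabulate⁺ (<⇒<ᵇ w<k))
      where
      j = toℕ w
      nm : ¬ T (misses (toℕ a ∸ s) j)
      nm = adjacent⇒¬misses w a s≤w (≤-reflexive (sym ea)) (symmetric _ _ ad)
      e0 : toℕ a ∸ s ≡ 0
      e0 = trans (cong (_∸ s) ea) (n∸n≡0 s)
      w<k : j < k
      w<k = ≰⇒> (λ k≤j → nm (subst (λ z → T (misses z j)) (sym e0) (T-∧-intro (≤⇒≤ᵇ (≤-trans k≤j (≤-reflexive (sym (+-identityʳ j)))))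
                          (<⇒<ᵇ (subst (_< k + d) (sym (+-identityʳ j)) (subst (j <_) (sym k+d≡s) s≤w))))))

  module SeparatorBound (W : Subset n) where
    ∣W∣ = count (lookup W)

    clique-joined : ∀ c0 → toℕ c0 < s → c0 ∉ W → ∀ c → toℕ c < s → c ∉ W → Reach G W c c0 × Reach G W c0 c
    clique-joined c0 c0s c0∉ c cs c∉ with c ≟ c0
    ... | yes refl = here c∉ , here c∉
    ... | no ne = step c∉ (clique-adjacent c c0 cs c0s ne) (here c0∉) , step c0∉ (clique-adjacent c0 c c0s cs (λ e → ne (sym e))) (here c∉)

    neighbourhood⊆W⇒k≤ : ∀ w → s ≤ toℕ w → (∀ c → toℕ c < s → Adj G w c → c ∈ W) → k ≤ ∣W∣
    neighbourhood⊆W⇒k≤ w s≤w N⊆W = injection≤count k neighbour (lookup W) neighbour-injective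
        (λ t → ∈⇒T-lookup (N⊆W (neighbour t) (neighbour<s t) (neighbour-adjacent t)))
      where
      i = toℕ w ∸ s
      -- The k clique neighbours of w: the first k clique indices, with those from its window on shifted by d.
      skip-window : ℕ → ℕ
      skip-window t = if t + i * d <ᵇ k then t else t + d
      skip-window<s : ∀ t → t < k → skip-window t < s
      skip-window<s t t< with T? (t + i * d <ᵇ k)
      ... | yes y = subst (_< s) (sym (if-true {b = t + i * d <ᵇ k} {t} {t + d} y)) (<-≤-trans t< k≤s)
      ... | no y = subst (_< s) (sym (if-false {b = t + i * d <ᵇ k} {t} {t + d} y)) (subst (t + d <_) k+d≡s (+-monoˡ-< d t<))
      skip-window-not-missed : ∀ t → ¬ T (misses i (skip-window t))
      skip-window-not-missed t tm with T? (t + i * d <ᵇ k)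
      ... | yes y = <⇒≱ (T<ᵇ⇒< {t + i * d} {k} y)
          (T≤ᵇ⇒≤ {k} {t + i * d} (T-∧-fst {k ≤ᵇ t + i * d} (subst (λ z → T (misses i z)) (if-true {b = t + i * d <ᵇ k} {t} {t + d} y) tm)))
      ... | no y = <⇒≱ (T<ᵇ⇒< {t + d + i * d} {k + d} (T-∧-snd {k ≤ᵇ t + d + i * d} tm')) le
        where
        tm' : T (misses i (t + d))
        tm' = subst (λ z → T (misses i z)) (if-false {b = t + i * d <ᵇ k} {t} {t + d} y) tm
        le : k + d ≤ t + d + i * d
        le = subst (k + d ≤_) (trans (+-assoc t (i * d) d) (trans (cong (t +_) (+-comm (i * d) d)) (sym (+-assoc t d (i * d)))))
               (+-monoˡ-≤ d (≮⇒≥ (λ x → y (<⇒<ᵇ {t + i * d} {k} x))))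
      neighbour : Fin k → Fin n
      neighbour t = clique-vertex (skip-window (toℕ t)) (skip-window<s (toℕ t) (toℕ<n t))
      neighbour<s : ∀ t → toℕ (neighbour t) < s
      neighbour<s t = subst (_< s) (sym (toℕ-clique-vertex (skip-window (toℕ t)) (skip-window<s (toℕ t) (toℕ<n t)))) (skip-window<s (toℕ t) (toℕ<n t))
      neighbour-adjacent : ∀ t → Adj G w (neighbour t)
      neighbour-adjacent t = symmetric _ _
          (¬misses⇒adjacent (neighbour t) w (neighbour<s t) s≤w (subst (λ z → ¬ T (misses i z)) (sym (toℕ-clique-vertex (skip-window (toℕ t)) (skip-window<s (toℕ t) (toℕ<n t)))) (skip-window-not-missed (toℕ t))))
      skip-window-injective : ∀ a b → skip-window a ≡ skip-window b → a ≡ b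
      skip-window-injective a b e with T? (a + i * d <ᵇ k) | T? (b + i * d <ᵇ k)
      ... | yes ya | yes yb = trans (sym (if-true {b = a + i * d <ᵇ k} {a} {a + d} ya)) (trans e (if-true {b = b + i * d <ᵇ k} {b} {b + d} yb))
      ... | no ya | no yb = +-cancelʳ-≡ d a b
          (trans (sym (if-false {b = a + i * d <ᵇ k} {a} {a + d} ya)) (trans e (if-false {b = b + i * d <ᵇ k} {b} {b + d} yb)))
      ... | yes ya | no yb = ⊥-elim (<⇒≱ (T<ᵇ⇒< {a + i * d} {k} ya) (≤-trans (≮⇒≥ (λ x → yb (<⇒<ᵇ {b + i * d} {k} x))) (+-monoˡ-≤ (i * d) (subst (b ≤_) (sym e') (m≤m+n b d)))))
        where
        e' : a ≡ b + d
        e' = trans (sym (if-true {b = a + i * d <ᵇ k} {a} {a + d} ya)) (trans e (if-false {b = b + i * d <ᵇ k} {b} {b + d} yb))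
      ... | no ya | yes yb = ⊥-elim (<⇒≱ (T<ᵇ⇒< {b + i * d} {k} yb) (≤-trans (≮⇒≥ (λ x → ya (<⇒<ᵇ {a + i * d} {k} x))) (+-monoˡ-≤ (i * d) (subst (a ≤_) e' (m≤m+n a d)))))
        where
        e' : a + d ≡ b
        e' = trans (sym (if-false {b = a + i * d <ᵇ k} {a} {a + d} ya)) (trans e (if-true {b = b + i * d <ᵇ k} {b} {b + d} yb))
      neighbour-injective : ∀ a b → neighbour a ≡ neighbour b → a ≡ b
      neighbour-injective a b e = toℕ-injective
          (skip-window-injective (toℕ a) (toℕ b) (trans (sym (toℕ-clique-vertex (skip-window (toℕ a)) (skip-window<s (toℕ a) (toℕ<n a)))) (trans (cong toℕ e) (toℕ-clique-vertex (skip-window (toℕ b)) (skip-window<s (toℕ b) (toℕ<n b))))))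

    ¬¬-joined : ∀ c₀ → toℕ c₀ < s → c₀ ∉ W → ∀ w → w ∉ W → DoubleNegation ((k ≤ ∣W∣) ⊎ (Reach G W w c₀ × Reach G W c₀ w))
    ¬¬-joined c₀ c₀<s c₀∉W w w∉W with toℕ w <? s
    ... | yes w<s = pure (inj₂ (clique-joined c₀ c₀<s c₀∉W w w<s w∉W))
    ... | no w≮s = do
      yes (c , c<s , c∉W , w~c) ← ¬¬-excluded-middle {A = Σ (Fin n) λ c → toℕ c < s × c ∉ W × Adj G w c}
        where no ∄c → pure (inj₁ (neighbourhood⊆W⇒k≤ w (≮⇒≥ w≮s) λ c c<s w~c →
                                     decidable-stable (c ∈? W) λ c∉W → ∄c (c , c<s , c∉W , w~c)))
      (c⇝c₀ , c₀⇝c) ← pure (clique-joined c₀ c₀<s c₀∉W c c<s c∉W)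
      pure (inj₂ (step w∉W w~c c⇝c₀ , reach-trans c₀⇝c (step c∉W (symmetric _ _ w~c) (here w∉W))))

    -- Either W contains the whole clique, or everything outside W is joined to a clique vertex c₀ ∉ W.
    ¬¬-k≤∣W∣ : Separating G W → DoubleNegation (k ≤ ∣W∣)
    ¬¬-k≤∣W∣ (u , v , u∉W , v∉W , u⇏v) = do
      yes (c₀ , c₀<s , c₀∉W) ← ¬¬-excluded-middle {A = Σ (Fin n) λ c → toℕ c < s × c ∉ W}
        where no ∄c₀ → pure (≤-trans k≤s (injection≤count s clique′ (lookup W) clique′-injective λ j →
                                decidable-stable (T? _) λ c∉W → ∄c₀ (clique′ j , clique′<s j , c∉W ∘ ∈⇒T-lookup)))
      inj₂ (u⇝c₀ , _) ← ¬¬-joined c₀ c₀<s c₀∉W u u∉W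
        where inj₁ k≤∣W∣ → pure k≤∣W∣
      inj₂ (_ , c₀⇝v) ← ¬¬-joined c₀ c₀<s c₀∉W v v∉W
        where inj₁ k≤∣W∣ → pure k≤∣W∣
      ⊥-elim (u⇏v (reach-trans u⇝c₀ c₀⇝v))
      where
      clique′ : Fin s → Fin n
      clique′ j = clique-vertex (toℕ j) (toℕ<n j)
      clique′<s : ∀ j → toℕ (clique′ j) < s
      clique′<s j = subst (_< s) (sym (toℕ-clique-vertex (toℕ j) (toℕ<n j))) (toℕ<n j)
      clique′-injective : ∀ a b → clique′ a ≡ clique′ b → a ≡ b
      clique′-injective a b e = toℕ-injective
          (trans (sym (toℕ-clique-vertex (toℕ a) (toℕ<n a))) (trans (cong toℕ e) (toℕ-clique-vertex (toℕ b) (toℕ<n b))))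

  lower : ∀ W → Separating G W → k ≤ ∣ W ∣
  lower W W-separating = subst (k ≤_) (sym (∣p∣≡count-lookup W)) (≤-stable (SeparatorBound.¬¬-k≤∣W∣ W W-separating))

  connectivity : IsConnectivity G k
  connectivity = (N⟨x₀⟩ , N⟨x₀⟩-separating , ∣N⟨x₀⟩∣≡k) , lower

  witness : ∃ λ (H : Graph n) → IsSimple H × Chordal* H × IsConnectivity H k
  witness = G , simple , (chordal , no-universal) , connectivity

ceiling-bounds : ∀ {n c} → 2 ≤ n → IsCeilTwoSqrt n c → 3 ≤ c × c ≤ n + 1
ceiling-bounds {n} {c} 2≤n (4n≤c² , c-least) = 3≤c , c-least (n + 1) (subst (λ z → 4 * z ≤ (n + 1) * (n + 1)) (*-identityʳ n) (4xy≤[x+y]² n 1))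
  where
  3≤c : 3 ≤ c
  3≤c with 3 ≤? c
  ... | yes 3≤c = 3≤c
  ... | no 3≰c = contradiction (≤-trans (*-monoʳ-≤ 4 2≤n) (≤-trans 4n≤c² (*-mono-≤ c≤2 c≤2))) (<⇒≱ {4} {8} (s≤s (s≤s (s≤s (s≤s (s≤s z≤n))))))
    where
    c≤2 : c ≤ 2
    c≤2 = ≤-pred (≰⇒> 3≰c)

k+c≤n+1 : ∀ n c k → 1 ≤ n → 2 ≤ c → c ≤ n + 1 → k ≤ (n ∸ 1) ∸ (c ∸ 2) → k + c ≤ n + 1
k+c≤n+1 (suc n) (suc (suc c)) k _ _ 2+c≤2+n k≤n∸c =
  subst₂ _≤_ (sym (trans (+-suc k (suc c)) (cong suc (+-suc k c)))) (cong suc (+-comm 1 n)) (s≤s (s≤s (m≤o∸n⇒m+n≤o k c≤n k≤n∸c)))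
  where
  c≤n : c ≤ n
  c≤n = ≤-pred (≤-pred (subst (suc (suc c) ≤_) (cong suc (+-comm n 1)) 2+c≤2+n))
k+c≤n+1 (suc n) (suc zero) k _ (s≤s ()) _ _

parity : ∀ t → Σ ℕ λ q → (t ≡ suc (2 * q)) ⊎ (t ≡ 2 * q)
parity zero = 0 , inj₂ refl
parity (suc t) with parity t
... | q , inj₁ t≡1+2q = suc q , inj₂ (trans (cong suc t≡1+2q) (sym (*-suc 2 q)))
... | q , inj₂ t≡2q = q , inj₁ (cong suc t≡2q)

4a≤4b+1⇒a≤b : ∀ a b → 4 * a ≤ 4 * b + 1 → a ≤ b
4a≤4b+1⇒a≤b a b 4a≤4b+1 with a ≤? b
... | yes a≤b = a≤b
... | no a≰b = contradiction (+-cancelˡ-≤ (4 * b) 4 1 (≤-trans (≤-reflexive (trans (+-comm (4 * b) 4) (sym (*-suc 4 b))))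
                                                            (≤-trans (*-monoʳ-≤ 4 (≰⇒> a≰b)) 4a≤4b+1))) λ { (s≤s ()) }

-- With m = ⌈c/2⌉ independent vertices and a clique of size s = n − m, the inequality 4n ≤ c² gives k ≤ (m − 1)(s − k).
split-parameters : ∀ n → 2 ≤ n → ∀ c → IsCeilTwoSqrt n c → ∀ k → k ≤ (n ∸ 1) ∸ (c ∸ 2) →
                   Σ ℕ λ s → Σ ℕ λ m → s + m ≡ n × k ≤ s × 2 ≤ m × k ≤ (m ∸ 1) * (s ∸ k)
split-parameters n 2≤n c c-ceil@(4n≤c² , _) k k≤ with parity (c ∸ 3)
... | q , inj₁ e = even (trans (sym (m+[n∸m]≡n 3≤c)) (cong (3 +_) e))
  where
  3≤c = proj₁ (ceiling-bounds 2≤n c-ceil)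
  even : c ≡ 4 + 2 * q → _
  even refl = s , 2 + q , trans (+-comm s (2 + q)) 2+q+s≡n , m≤m+n k (q + 1 + e′) , s≤s (s≤s z≤n) ,
              subst₂ (λ x y → k ≤ x * y) (+-comm q 1) (sym (m+n∸m≡n k (q + 1 + e′))) k≤[q+1][q+1+e′]
    where
    regroup : ∀ q k → (2 + q) + (k + (q + 1)) + 1 ≡ k + (4 + 2 * q)
    regroup = solve-∀
    regroup-e : ∀ q k e → (2 + q) + (k + (q + 1)) + e ≡ (2 + q) + (k + (q + 1 + e))
    regroup-e = solve-∀
    expand-4n : ∀ q k e → 4 * ((2 + q) + (k + (q + 1 + e))) ≡ 4 * (k + e) + 4 * (2 * q + 3)
    expand-4n = solve-∀
    expand-c² : ∀ q → (4 + 2 * q) * (4 + 2 * q) ≡ 4 * ((q + 1) * (q + 1)) + 4 * (2 * q + 3)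
    expand-c² = solve-∀
    distrib : ∀ q e → (q + 1) * (q + 1 + e) ≡ (q + 1) * (q + 1) + (q + 1) * e
    distrib = solve-∀
    2+q+k+q+1≤n : (2 + q) + (k + (q + 1)) ≤ n
    2+q+k+q+1≤n = +-cancelʳ-≤ 1 _ _
        (subst (_≤ n + 1) (sym (regroup q k)) (k+c≤n+1 n c k (≤-trans (s≤s z≤n) 2≤n) (≤-trans (s≤s (s≤s z≤n)) 3≤c) (proj₂ (ceiling-bounds 2≤n c-ceil)) k≤))
    e′ = proj₁ (m≤n⇒∃[o]m+o≡n 2+q+k+q+1≤n)
    s = k + (q + 1 + e′)
    2+q+s≡n : (2 + q) + s ≡ n
    2+q+s≡n = trans (sym (regroup-e q k e′)) (proj₂ (m≤n⇒∃[o]m+o≡n 2+q+k+q+1≤n))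
    k+e′≤[q+1]² : k + e′ ≤ (q + 1) * (q + 1)
    k+e′≤[q+1]² = *-cancelˡ-≤ 4 (+-cancelʳ-≤ (4 * (2 * q + 3)) _ _
                    (subst₂ _≤_ (expand-4n q k e′) (expand-c² q) (subst (λ z → 4 * z ≤ (4 + 2 * q) * (4 + 2 * q)) (sym 2+q+s≡n) 4n≤c²)))
    k≤[q+1][q+1+e′] : k ≤ (q + 1) * (q + 1 + e′)
    k≤[q+1][q+1+e′] = ≤-trans (m+n≤o⇒m≤o k k+e′≤[q+1]²) (subst ((q + 1) * (q + 1) ≤_) (sym (distrib q e′)) (m≤m+n _ _))
... | q , inj₂ e = odd (trans (sym (m+[n∸m]≡n 3≤c)) (cong (3 +_) e))
  where
  3≤c = proj₁ (ceiling-bounds 2≤n c-ceil)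
  odd : c ≡ 3 + 2 * q → _
  odd refl = s , 2 + q , trans (+-comm s (2 + q)) 2+q+s≡n , m≤m+n k (q + e′) , s≤s (s≤s z≤n) ,
             subst₂ (λ x y → k ≤ x * y) (+-comm q 1) (sym (m+n∸m≡n k (q + e′))) k≤[q+1][q+e′]
    where
    regroup : ∀ q k → (2 + q) + (k + q) + 1 ≡ k + (3 + 2 * q)
    regroup = solve-∀
    regroup-e : ∀ q k e → (2 + q) + (k + q) + e ≡ (2 + q) + (k + (q + e))
    regroup-e = solve-∀
    expand-4n : ∀ q k e → 4 * ((2 + q) + (k + (q + e))) ≡ 4 * (k + e) + 4 * (2 * q + 2)
    expand-4n = solve-∀
    expand-c² : ∀ q → (3 + 2 * q) * (3 + 2 * q) ≡ 4 * (q * q + q) + 1 + 4 * (2 * q + 2)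
    expand-c² = solve-∀
    distrib : ∀ q e → (q + 1) * (q + e) ≡ (q * q + q) + (q + 1) * e
    distrib = solve-∀
    2+q+k+q≤n : (2 + q) + (k + q) ≤ n
    2+q+k+q≤n = +-cancelʳ-≤ 1 _ _
        (subst (_≤ n + 1) (sym (regroup q k)) (k+c≤n+1 n c k (≤-trans (s≤s z≤n) 2≤n) (≤-trans (s≤s (s≤s z≤n)) 3≤c) (proj₂ (ceiling-bounds 2≤n c-ceil)) k≤))
    e′ = proj₁ (m≤n⇒∃[o]m+o≡n 2+q+k+q≤n)
    s = k + (q + e′)
    2+q+s≡n : (2 + q) + s ≡ n
    2+q+s≡n = trans (sym (regroup-e q k e′)) (proj₂ (m≤n⇒∃[o]m+o≡n 2+q+k+q≤n))
    k+e′≤q²+q : k + e′ ≤ q * q + q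
    k+e′≤q²+q = 4a≤4b+1⇒a≤b _ _ (+-cancelʳ-≤ (4 * (2 * q + 2)) _ _
                  (subst₂ _≤_ (expand-4n q k e′) (expand-c² q) (subst (λ z → 4 * z ≤ (3 + 2 * q) * (3 + 2 * q)) (sym 2+q+s≡n) 4n≤c²)))
    k≤[q+1][q+e′] : k ≤ (q + 1) * (q + e′)
    k≤[q+1][q+e′] = ≤-trans (m+n≤o⇒m≤o k k+e′≤q²+q) (subst (q * q + q ≤_) (sym (distrib q e′)) (m≤m+n _ _))

theorem1p1 : (n : ℕ) → 2 ≤ n → (c : ℕ) → IsCeilTwoSqrt n c →
    ((G : Graph n) → IsSimple G → Chordal* G →
       (k t : ℕ) → IsConnectivity G k → IsTauMax (complement G) t →
       (k + t ≤ n ∸ 1) × (0 ≤ k × k ≤ (n ∸ 1) ∸ (c ∸ 2)))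
    × ((k : ℕ) → k ≤ (n ∸ 1) ∸ (c ∸ 2) →
       ∃ λ (G : Graph n) → IsSimple G × Chordal* G × IsConnectivity G k)
theorem1p1 n 2≤n c c-ceil = bounds , realised
  where
  v₀ : Fin n
  v₀ = fromℕ< (≤-trans (s≤s z≤n) 2≤n)
  bounds : (G : Graph n) → IsSimple G → Chordal* G → (k t : ℕ) → IsConnectivity G k → IsTauMax (complement G) t →
           (k + t ≤ n ∸ 1) × (0 ≤ k × k ≤ (n ∸ 1) ∸ (c ∸ 2))
  bounds G simple chordal* k t κ τmax =
    κ+τmax≤n-1 G v₀ simple chordal* κ τmax , z≤n , κ≤n-1-[c-2] G v₀ simple chordal* c-ceil κ
  realised : (k : ℕ) → k ≤ (n ∸ 1) ∸ (c ∸ 2) → ∃ λ (G : Graph n) → IsSimple G × Chordal* G × IsConnectivity G k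
  realised k k≤ with split-parameters n 2≤n c c-ceil k k≤
  ... | s , m , s+m≡n , k≤s , 2≤m , k≤[m-1][s-k] = Construction.witness n s m k s+m≡n k≤s 2≤m k≤[m-1][s-k]
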